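{- Let $p$ be a prime, $e \ge 1$, $\overline{X} = (X_1, \ldots, X_n)$, and define $\mathbb{Z}/p^e\mathbb{Z}(\overline{X}^p) = \{f(X_1^p, \ldots, X_n^p) \mid f \in \mathbb{Z}/p^e\mathbb{Z}(\overline{X})\}$. Then, as a $\mathbb{Z}/p^e\mathbb{Z}(\overline{X}^p)$-module, \[ \mathbb{Z}/p^e\mathbb{Z}(\overline{X}) = \bigoplus_{r_1, \ldots, r_n \in \{0, 1, \ldots, p-1\}} \mathbb{Z}/p^e\mathbb{Z}(\overline{X}^p) \cdot X_1^{r_1} X_2^{r_2} \cdots X_n^{r_n}. \]
   Context: $\mathbb{Z}/p^e\mathbb{Z}(\overline{X}) = \{f/g \mid f, g \in \mathbb{Z}/p^e\mathbb{Z}[X_1, \ldots, X_n],\ p \nmid g\}$, the localization of $\mathbb{Z}/p^e\mathbb{Z}[X_1^{\pm1}, \ldots, X_n^{\pm1}]$ at the prime ideal $\langle p \rangle$. -}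

module Defs where

open import Data.Nat as ℕ using (ℕ; _^_)
open import Data.Integer as ℤ using (ℤ; +_; _-_)
open import Data.Integer.Divisibility using (_∣_)
open import Data.Fin using (Fin; toℕ)
open import Data.Fin.Base using () renaming (zero to fzero)
open import Data.List using (List; []; _∷_; [_]; _++_; map; concatMap; foldr)
open import Data.List.Base using (allFin)
open import Data.Vec as Vec using (Vec; zipWith; replicate)
open import Data.Vec.Properties using (≡-dec)
open import Data.Product using (_×_; _,_; ∃; ∃-syntax)
open import Relation.Nullary using (¬_; yes; no)

Mono : ℕ → Set
Mono n = Vec ℕ n

-- A polynomial is a finite formal sum of terms c·X^m with integer coefficients;
-- the coefficient ring ℤ/p^e ℤ is realised below by comparing coefficients modulo p^e.
Poly : ℕ → Set
Poly n = List (ℤ × Mono n)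

coeff : ∀ {n} → Poly n → Mono n → ℤ
coeff [] m = + 0
coeff ((c , m') ∷ f) m with ≡-dec ℕ._≟_ m' m
... | yes _ = c ℤ.+ coeff f m
... | no  _ = coeff f m

_+P_ : ∀ {n} → Poly n → Poly n → Poly n
f +P g = f ++ g

_*P_ : ∀ {n} → Poly n → Poly n → Poly n
f *P g = concatMap (λ { (a , m) → map (λ { (b , m') → (a ℤ.* b , zipWith ℕ._+_ m m') }) g }) f

monoP : ∀ {n} → Mono n → Poly n
monoP m = [ (+ 1 , m) ]

frobP : ∀ {n} → ℕ → Poly n → Poly n
frobP p f = map (λ { (c , m) → (c , Vec.map (p ℕ.*_) m) }) f

allIdx : (p k : ℕ) → List (Vec (Fin p) k)
allIdx p ℕ.zero = [ Vec.[] ]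
allIdx p (ℕ.suc k) = concatMap (λ i → map (i Vec.∷_) (allIdx p k)) (allFin p)

module Loc (p e n : ℕ) where

  _≈P_ : Poly n → Poly n → Set
  f ≈P g = ∀ m → (+ (p ^ e)) ∣ (coeff f m - coeff g m)

  NotDivP : Poly n → Set
  NotDivP g = ∃[ m ] ¬ ((+ p) ∣ coeff g m)

  record Frac : Set where
    constructor _/_
    field
      num : Poly n
      den : Poly n
  open Frac public

  -- elements of ℤ/p^e ℤ(X̄): fractions with p ∤ denominator
  Valid : Frac → Set
  Valid φ = NotDivP (den φ)

  _≈_ : Frac → Frac → Set
  φ ≈ ψ = ∃[ s ] (NotDivP s × ((s *P (num φ *P den ψ)) ≈P (s *P (num ψ *P den φ))))

  _+F_ : Frac → Frac → Frac
  (f / g) +F (f' / g') = ((f *P g') +P (f' *P g)) / (g *P g')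

  _*F_ : Frac → Frac → Frac
  (f / g) *F (f' / g') = (f *P f') / (g *P g')

  oneP : Poly n
  oneP = monoP (replicate n 0)

  0F : Frac
  0F = [] / oneP

  monoF : Mono n → Frac
  monoF m = monoP m / oneP

  frobF : Frac → Frac
  frobF (f / g) = frobP p f / frobP p g

  InFrobImage : Frac → Set
  InFrobImage c = ∃[ ψ ] (Valid ψ × (c ≈ frobF ψ))

  Index : Set
  Index = Vec (Fin p) n

  Xpow : Index → Frac
  Xpow r = monoF (Vec.map toℕ r)

  combo : (Index → Frac) → Frac
  combo c = foldr (λ r acc → (c r *F Xpow r) +F acc) 0F (allIdx p n)

  Coeffs : (Index → Frac) → Set
  Coeffs c = ∀ r → Valid (c r) × InFrobImage (c r)

-- Write q = p^e. If p ∤ g then g^q ≡ H(X₁^p, …, Xₙ^p) modulo q for some H with p ∤ H: modulo p this is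
-- the freshman's dream g^p ≡ g⁽ᵖ⁾(X₁^p, …, Xₙ^p), and a ≡ b modulo p^k implies a^p ≡ b^p modulo p^(k+1).
-- Hence f/g = F/H(X̄^p) with F = f g^(q-1), and splitting every exponent vector of F as p·w + r with
-- 0 ≤ rᵢ < p writes F = Σᵣ Fᵣ(X̄^p) X^r, so that f/g = Σᵣ (Fᵣ/H)(X̄^p) X^r. Conversely, bring two such
-- combinations to common denominators W(X̄^p) and W′(X̄^p). The witness s ∉ ⟨p⟩ of their equality in the
-- localisation may be replaced by s^q ≡ T(X̄^p), and multiplication by polynomials in X̄^p does not mix
-- the residues r, so the numerators agree component by component. That p ∤ f and p ∤ g imply p ∤ f g
-- (so that the fractions form a localisation at all) is Gauss's lemma, proved with lexicographically
-- largest monomials.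

module Submission where

open import Defs
open import Algebra.Bundles using (CommutativeRing)
import Algebra.Properties.CommutativeSemiring.Binomial as Binomial
import Algebra.Properties.Group as GroupProperties
import Algebra.Properties.Monoid.Sum as MonoidSum
import Algebra.Properties.Semiring.Exp as SemiringExp
import Algebra.Properties.Semiring.Mult as SemiringMult
import Algebra.Solver.Ring.NaturalCoefficients.Default as NatSolver
open import Data.Empty using (⊥-elim)
open import Data.Fin as Fin using (Fin; toℕ; fromℕ<; inject₁; fromℕ)
import Data.Fin.Properties as FinP
open import Data.Integer as ℤ using (ℤ; +_; -_; _+_; _*_; _-_; 0ℤ)
import Data.Integer.Properties as ℤP
open import Algebra.Properties.CommutativeSemigroup ℤP.+-commutativeSemigroup
  using () renaming (interchange to +-interchange)
open import Data.Integer.Divisibility.Signed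
  using (_∣_; _∣?_; divides; ∣-trans; ∣m∣n⇒∣m+n; ∣m⇒∣-m; ∣n⇒∣m*n; ∣m⇒∣m*n; *-monoʳ-∣; *-monoˡ-∣; ∣⇒∣ᵤ; ∣ᵤ⇒∣; 0∣⇒≡0)
open import Data.Integer.Tactic.RingSolver using (solve-∀)
open import Data.List
  using (List; []; _∷_; _++_; [_]; map; concatMap; foldr; filter; deduplicate; allFin; cartesianProductWith)
import Data.List.Properties as ListP
open import Data.List.Membership.Propositional using (_∈_; _∉_)
import Data.List.Membership.Propositional.Properties as ∈P
import Data.List.Membership.DecPropositional as DecMembership
open import Data.List.Relation.Unary.All as All using (All; []; _∷_)
open import Data.List.Relation.Unary.All.Properties using (all-filter)
open import Data.List.Relation.Unary.AllPairs using ([]; _∷_)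
open import Data.List.Relation.Unary.Any using (here; there)
open import Data.List.Relation.Unary.Unique.Propositional using (Unique)
import Data.List.Relation.Unary.Unique.Propositional.Properties as UniqueP
import Data.List.Relation.Unary.Unique.DecPropositional.Properties as DecUniqueP
open import Data.Nat as ℕ using (ℕ; zero; suc; _<_; _≤_; _^_; _!)
import Data.Nat.Properties as ℕP
import Data.Nat.Divisibility as ND
open import Data.Nat.DivMod using ([m+kn]%n≡m%n; m<n⇒m%n≡m; m≡m%n+[m/n]*n; m%n<n; m*n/n≡m)
open import Data.Nat.Combinatorics using (_C_; nCk≡n!/k![n-k]!; k![n∸k]!∣n!; nCn≡1)
open import Data.Nat.Primality using (Prime; euclidsLemma; prime⇒nonTrivial; prime⇒nonZero)
open import Data.Product using (_×_; _,_; ∃; ∃-syntax; proj₁; proj₂; swap)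
open import Data.Sum using (_⊎_; inj₁; inj₂)
open import Data.Unit using (⊤; tt)
open import Data.Vec as Vec using (Vec; zipWith; replicate)
open import Data.Vec.Properties using (≡-dec; ∷-injective; zipWith-comm; zipWith-assoc; zipWith-identityˡ)
open import Function using (_∘_; _$_)
open import Level using (_⊔_)
open import Relation.Binary using (tri<; tri≈; tri>)
open import Relation.Binary.Definitions using (DecidableEquality)
open import Relation.Binary.PropositionalEquality hiding ([_])
import Relation.Binary.Reasoning.Setoid as SetoidReasoning
open import Relation.Nullary using (¬_; yes; no; Dec; ¬?)
open import Relation.Nullary.Decidable using (decidable-stable)
open import Relation.Unary using (Decidable)

∣0 : ∀ {d} → d ∣ 0ℤ
∣0 {d} = divides 0ℤ (sym (ℤP.*-zeroˡ d))

∑ : {A : Set} → List A → (A → ℤ) → ℤ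
∑ []       F = 0ℤ
∑ (x ∷ xs) F = F x + ∑ xs F

ind : {P : Set} → Dec P → ℤ → ℤ
ind (yes _) a = a
ind (no  _) a = 0ℤ

module _ {A : Set} where

  ∑-cong : (xs : List A) {F G : A → ℤ} → (∀ x → F x ≡ G x) → ∑ xs F ≡ ∑ xs G
  ∑-cong []       F≗G = refl
  ∑-cong (x ∷ xs) F≗G = cong₂ _+_ (F≗G x) (∑-cong xs F≗G)

  ∑-congᴬ : {xs : List A} {F G : A → ℤ} → All (λ x → F x ≡ G x) xs → ∑ xs F ≡ ∑ xs G
  ∑-congᴬ []       = refl
  ∑-congᴬ (e ∷ es) = cong₂ _+_ e (∑-congᴬ es)

  ∑-zero : (xs : List A) → ∑ xs (λ _ → 0ℤ) ≡ 0ℤ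
  ∑-zero []       = refl
  ∑-zero (x ∷ xs) = trans (ℤP.+-identityˡ _) (∑-zero xs)

  ∑-++ : (xs ys : List A) (F : A → ℤ) → ∑ (xs ++ ys) F ≡ ∑ xs F + ∑ ys F
  ∑-++ []       ys F = sym (ℤP.+-identityˡ _)
  ∑-++ (x ∷ xs) ys F = trans (cong (_+_ (F x)) (∑-++ xs ys F)) (sym (ℤP.+-assoc (F x) _ _))

  ∑-distrib-+ : (xs : List A) (F G : A → ℤ) → ∑ xs (λ x → F x + G x) ≡ ∑ xs F + ∑ xs G
  ∑-distrib-+ []       F G = refl
  ∑-distrib-+ (x ∷ xs) F G =
    trans (cong (_+_ (F x + G x)) (∑-distrib-+ xs F G)) (+-interchange (F x) (G x) _ _)

  ∑-*ˡ : (xs : List A) (c : ℤ) (F : A → ℤ) → ∑ xs (λ x → c * F x) ≡ c * ∑ xs F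
  ∑-*ˡ []       c F = sym (ℤP.*-zeroʳ c)
  ∑-*ˡ (x ∷ xs) c F = trans (cong (_+_ (c * F x)) (∑-*ˡ xs c F)) (sym (ℤP.*-distribˡ-+ c (F x) _))

  ∑-*ʳ : (xs : List A) (F : A → ℤ) (c : ℤ) → ∑ xs (λ x → F x * c) ≡ ∑ xs F * c
  ∑-*ʳ xs F c = trans (∑-cong xs (λ x → ℤP.*-comm (F x) c)) (trans (∑-*ˡ xs c F) (ℤP.*-comm c _))

  ∑-neg : (xs : List A) (F : A → ℤ) → ∑ xs (λ x → - F x) ≡ - ∑ xs F
  ∑-neg []       F = refl
  ∑-neg (x ∷ xs) F = trans (cong (_+_ (- F x)) (∑-neg xs F)) (sym (ℤP.neg-distrib-+ (F x) _))

  ∑-sub : (xs : List A) (F G : A → ℤ) → ∑ xs F - ∑ xs G ≡ ∑ xs (λ x → F x - G x)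
  ∑-sub xs F G = trans (cong (_+_ (∑ xs F)) (sym (∑-neg xs G))) (sym (∑-distrib-+ xs F (λ x → - G x)))

  ∑-∣ : ∀ {d} (xs : List A) (F : A → ℤ) → (∀ x → d ∣ F x) → d ∣ ∑ xs F
  ∑-∣ []       F d∣F = ∣0
  ∑-∣ (x ∷ xs) F d∣F = ∣m∣n⇒∣m+n (d∣F x) (∑-∣ xs F d∣F)

  ∑-filter : {P : A → Set} (P? : Decidable P) (xs : List A) (F : A → ℤ) →
             ∑ (filter P? xs) F ≡ ∑ xs (λ x → ind (P? x) (F x))
  ∑-filter P? []       F = refl
  ∑-filter P? (x ∷ xs) F with P? x
  ... | yes _ = cong (_+_ (F x)) (∑-filter P? xs F)
  ... | no  _ = trans (∑-filter P? xs F) (sym (ℤP.+-identityˡ _))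

module _ {A B : Set} where

  ∑-map : (h : A → B) (xs : List A) (F : B → ℤ) → ∑ (map h xs) F ≡ ∑ xs (F ∘ h)
  ∑-map h []       F = refl
  ∑-map h (x ∷ xs) F = cong (_+_ (F (h x))) (∑-map h xs F)

  ∑-concatMap : (g : A → List B) (xs : List A) (F : B → ℤ) →
                ∑ (concatMap g xs) F ≡ ∑ xs (λ x → ∑ (g x) F)
  ∑-concatMap g []       F = refl
  ∑-concatMap g (x ∷ xs) F =
    trans (∑-++ (g x) (concatMap g xs) F) (cong (_+_ (∑ (g x) F)) (∑-concatMap g xs F))

  ∑-swap : (xs : List A) (ys : List B) (F : A → B → ℤ) →
           ∑ xs (λ x → ∑ ys (F x)) ≡ ∑ ys (λ y → ∑ xs (λ x → F x y))
  ∑-swap []       ys F = sym (∑-zero ys)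
  ∑-swap (x ∷ xs) ys F =
    trans (cong (_+_ (∑ ys (F x))) (∑-swap xs ys F)) (sym (∑-distrib-+ ys (F x) (λ y → ∑ xs (λ x′ → F x′ y))))

module _ {P : Set} where

  ind-⇔ : {Q : Set} (P? : Dec P) (Q? : Dec Q) → (P → Q) → (Q → P) → ∀ a → ind P? a ≡ ind Q? a
  ind-⇔ (yes _) (yes _) P→Q Q→P a = refl
  ind-⇔ (yes p) (no ¬q) P→Q Q→P a = ⊥-elim (¬q (P→Q p))
  ind-⇔ (no ¬p) (yes q) P→Q Q→P a = ⊥-elim (¬p (Q→P q))
  ind-⇔ (no _)  (no _)  P→Q Q→P a = refl

  ind-∧ : {Q R : Set} (P? : Dec P) (Q? : Dec Q) (R? : Dec R) → (P → Q × R) → (Q → R → P) →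
          ∀ a → ind P? a ≡ ind Q? (ind R? a)
  ind-∧ (yes _) (yes _) (yes _) P→QR QR→P a = refl
  ind-∧ (yes p) (no ¬q) _       P→QR QR→P a = ⊥-elim (¬q (proj₁ (P→QR p)))
  ind-∧ (yes p) (yes _) (no ¬r) P→QR QR→P a = ⊥-elim (¬r (proj₂ (P→QR p)))
  ind-∧ (no ¬p) (yes q) (yes r) P→QR QR→P a = ⊥-elim (¬p (QR→P q r))
  ind-∧ (no _)  (no _)  _       P→QR QR→P a = refl
  ind-∧ (no _)  (yes _) (no _)  P→QR QR→P a = refl

  ind-no : (P? : Dec P) → ¬ P → ∀ a → ind P? a ≡ 0ℤ
  ind-no (yes p) ¬p a = ⊥-elim (¬p p)
  ind-no (no _)  ¬p a = refl

  ind-yes : (P? : Dec P) → P → ∀ a → ind P? a ≡ a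
  ind-yes (yes _) p a = refl
  ind-yes (no ¬p) p a = ⊥-elim (¬p p)

  ind-zero : (P? : Dec P) → ind P? 0ℤ ≡ 0ℤ
  ind-zero (yes _) = refl
  ind-zero (no _)  = refl

  ind-* : (P? : Dec P) (c a : ℤ) → ind P? (c * a) ≡ c * ind P? a
  ind-* (yes _) c a = refl
  ind-* (no _)  c a = sym (ℤP.*-zeroʳ c)

  ind-neg : (P? : Dec P) (a : ℤ) → ind P? (- a) ≡ - ind P? a
  ind-neg (yes _) a = refl
  ind-neg (no _)  a = refl

  ind-self : (P? : Dec P) {a : ℤ} → (¬ P → a ≡ 0ℤ) → ind P? a ≡ a
  ind-self (yes _) _    = refl
  ind-self (no ¬p) a≡0 = sym (a≡0 ¬p)

  ∑-ind : {A : Set} (P? : Dec P) (xs : List A) (F : A → ℤ) → ∑ xs (λ x → ind P? (F x)) ≡ ind P? (∑ xs F)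
  ∑-ind (yes _) xs F = refl
  ∑-ind (no _)  xs F = ∑-zero xs

module _ {A : Set} (_≟_ : DecidableEquality A) where
  open DecMembership _≟_ using (_∈?_)

  ∑-δ : {S : List A} → Unique S → (m : A) (F : A → ℤ) → ∑ S (λ u → ind (u ≟ m) (F u)) ≡ ind (m ∈? S) (F m)
  ∑-δ {[]} [] m F = refl
  ∑-δ {x ∷ S} (x∉S ∷ uS) m F with x ≟ m
  ... | yes refl = begin
    F x + ∑ S (λ u → ind (u ≟ x) (F u)) ≡⟨ cong (_+_ (F x)) (∑-δ uS x F) ⟩
    F x + ind (x ∈? S) (F x)            ≡⟨ cong (_+_ (F x)) (ind-no (x ∈? S) (λ x∈S → All.lookup x∉S x∈S refl) (F x)) ⟩
    F x + 0ℤ                            ≡⟨ ℤP.+-identityʳ (F x) ⟩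
    F x                                 ≡⟨ sym (ind-yes (x ∈? (x ∷ S)) (here refl) (F x)) ⟩
    ind (x ∈? (x ∷ S)) (F x)            ∎
    where open ≡-Reasoning
  ... | no x≢m = trans (ℤP.+-identityˡ _) (trans (∑-δ uS m F)
    (ind-⇔ (m ∈? S) (m ∈? (x ∷ S)) there (λ { (here m≡x) → ⊥-elim (x≢m (sym m≡x)) ; (there m∈S) → m∈S }) (F m)))

module _ {n : ℕ} where

  infixl 6 _⊕_
  _⊕_ : Mono n → Mono n → Mono n
  _⊕_ = zipWith ℕ._+_

  𝟎 : Mono n
  𝟎 = replicate n 0

  ⊕-comm : (u v : Mono n) → u ⊕ v ≡ v ⊕ u
  ⊕-comm = zipWith-comm ℕP.+-comm

  ⊕-assoc : (u v w : Mono n) → (u ⊕ v) ⊕ w ≡ u ⊕ (v ⊕ w)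
  ⊕-assoc = zipWith-assoc ℕP.+-assoc

  ⊕-identityˡ : (u : Mono n) → 𝟎 ⊕ u ≡ u
  ⊕-identityˡ = zipWith-identityˡ ℕP.+-identityˡ

⊕-cancelˡ : ∀ {n} (u v w : Mono n) → u ⊕ v ≡ u ⊕ w → v ≡ w
⊕-cancelˡ Vec.[]      Vec.[]      Vec.[]      e = refl
⊕-cancelˡ (a Vec.∷ u) (b Vec.∷ v) (c Vec.∷ w) e with ∷-injective e
... | a+b≡a+c , u⊕v≡u⊕w = cong₂ Vec._∷_ (ℕP.+-cancelˡ-≡ a b c a+b≡a+c) (⊕-cancelˡ u v w u⊕v≡u⊕w)

_∣ᵐ_ : ∀ {n} → Mono n → Mono n → Set
u ∣ᵐ m = ∃ λ w → u ⊕ w ≡ m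

_∣ᵐ?_ : ∀ {n} (u m : Mono n) → Dec (u ∣ᵐ m)
Vec.[]      ∣ᵐ? Vec.[]      = yes (Vec.[] , refl)
(b Vec.∷ u) ∣ᵐ? (a Vec.∷ m) with b ℕ.≤? a | u ∣ᵐ? m
... | no b≰a | _ = no λ { (c Vec.∷ w , e) → b≰a (subst (b ℕ.≤_) (proj₁ (∷-injective e)) (ℕP.m≤m+n b c)) }
... | yes _  | no u∤m = no λ { (c Vec.∷ w , e) → u∤m (w , proj₂ (∷-injective e)) }
... | yes b≤a | yes (w , e) = yes ((a ℕ.∸ b) Vec.∷ w , cong₂ Vec._∷_ (ℕP.m+[n∸m]≡n b≤a) e)

_·ᵐ_ : ∀ {n} → ℕ → Mono n → Mono n
k ·ᵐ w = Vec.map (k ℕ.*_) w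

·ᵐ-distrib-⊕ : ∀ {n} k (u v : Mono n) → k ·ᵐ (u ⊕ v) ≡ k ·ᵐ u ⊕ k ·ᵐ v
·ᵐ-distrib-⊕ k Vec.[]      Vec.[]      = refl
·ᵐ-distrib-⊕ k (a Vec.∷ u) (b Vec.∷ v) = cong₂ Vec._∷_ (ℕP.*-distribˡ-+ k a b) (·ᵐ-distrib-⊕ k u v)

·ᵐ-zeroʳ : ∀ {n} k → k ·ᵐ 𝟎 {n} ≡ 𝟎
·ᵐ-zeroʳ {zero}  k = refl
·ᵐ-zeroʳ {suc n} k = cong₂ Vec._∷_ (ℕP.*-zeroʳ k) (·ᵐ-zeroʳ k)

·ᵐ-zeroˡ : ∀ {n} (u : Mono n) → 0 ·ᵐ u ≡ 𝟎
·ᵐ-zeroˡ Vec.[]      = refl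
·ᵐ-zeroˡ (a Vec.∷ u) = cong (0 Vec.∷_) (·ᵐ-zeroˡ u)

·ᵐ-suc : ∀ {n} k (u : Mono n) → suc k ·ᵐ u ≡ u ⊕ k ·ᵐ u
·ᵐ-suc k Vec.[]      = refl
·ᵐ-suc k (a Vec.∷ u) = cong (_ Vec.∷_) (·ᵐ-suc k u)

·ᵐ-cancelˡ : ∀ {n} k .{{_ : ℕ.NonZero k}} (u v : Mono n) → k ·ᵐ u ≡ k ·ᵐ v → u ≡ v
·ᵐ-cancelˡ k Vec.[]      Vec.[]      e = refl
·ᵐ-cancelˡ k (a Vec.∷ u) (b Vec.∷ v) e with ∷-injective e
... | ka≡kb , ku≡kv = cong₂ Vec._∷_ (ℕP.*-cancelˡ-≡ a b k ka≡kb) (·ᵐ-cancelˡ k u v ku≡kv)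

IsPower : ∀ {n} → ℕ → Mono n → Set
IsPower k m = ∃ λ w → k ·ᵐ w ≡ m

isPower? : ∀ {n} k (m : Mono n) → Dec (IsPower k m)
isPower? k Vec.[] = yes (Vec.[] , refl)
isPower? k (a Vec.∷ m) with k ND.∣? a | isPower? k m
... | no k∤a | _ = no λ { (c Vec.∷ w , e) → k∤a (ND.divides c (trans (sym (proj₁ (∷-injective e))) (ℕP.*-comm k c))) }
... | yes _ | no ¬pow = no λ { (c Vec.∷ w , e) → ¬pow (w , proj₂ (∷-injective e)) }
... | yes (ND.divides c a≡ck) | yes (w , e) = yes (c Vec.∷ w , cong₂ Vec._∷_ (trans (ℕP.*-comm k c) (sym a≡ck)) e)

Term : ℕ → Set
Term n = ℤ × Mono n

module _ {n : ℕ} where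

  infix 4 _≟ᵐ_
  _≟ᵐ_ : DecidableEquality (Mono n)
  _≟ᵐ_ = ≡-dec ℕ._≟_

  coeffᵗ : Mono n → Term n → ℤ
  coeffᵗ m (c , u) = ind (u ≟ᵐ m) c

  coeff-∑ : (f : Poly n) (m : Mono n) → coeff f m ≡ ∑ f (coeffᵗ m)
  coeff-∑ []             m = refl
  coeff-∑ ((c , u) ∷ f) m with u ≟ᵐ m
  ... | yes _ = cong (_+_ c) (coeff-∑ f m)
  ... | no  _ = trans (coeff-∑ f m) (sym (ℤP.+-identityˡ _))

  coeff-+P : (f g : Poly n) (m : Mono n) → coeff (f +P g) m ≡ coeff f m + coeff g m
  coeff-+P f g m = begin
    coeff (f ++ g) m              ≡⟨ coeff-∑ (f ++ g) m ⟩
    ∑ (f ++ g) (coeffᵗ m)         ≡⟨ ∑-++ f g (coeffᵗ m) ⟩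
    ∑ f (coeffᵗ m) + ∑ g (coeffᵗ m) ≡⟨ sym (cong₂ _+_ (coeff-∑ f m) (coeff-∑ g m)) ⟩
    coeff f m + coeff g m         ∎
    where open ≡-Reasoning

  infix 25 -P_
  -P_ : Poly n → Poly n
  -P f = map (λ (c , u) → (- c , u)) f

  coeff--P : (f : Poly n) (m : Mono n) → coeff (-P f) m ≡ - coeff f m
  coeff--P f m = begin
    coeff (-P f) m                       ≡⟨ coeff-∑ (-P f) m ⟩
    ∑ (-P f) (coeffᵗ m)                  ≡⟨ ∑-map _ f (coeffᵗ m) ⟩
    ∑ f (λ (c , u) → ind (u ≟ᵐ m) (- c)) ≡⟨ ∑-cong f (λ (c , u) → ind-neg (u ≟ᵐ m) c) ⟩
    ∑ f (λ t → - coeffᵗ m t)             ≡⟨ ∑-neg f (coeffᵗ m) ⟩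
    - ∑ f (coeffᵗ m)                     ≡⟨ cong -_ (sym (coeff-∑ f m)) ⟩
    - coeff f m                          ∎
    where open ≡-Reasoning

  _*ᵗ_ : Term n → Term n → Term n
  (a , u) *ᵗ (b , v) = (a * b , u ⊕ v)

  ∑-*P : (f g : Poly n) (F : Term n → ℤ) → ∑ (f *P g) F ≡ ∑ f (λ x → ∑ g (λ y → F (x *ᵗ y)))
  ∑-*P f g F = trans (∑-concatMap _ f F) (∑-cong f (λ x → ∑-map _ g F))

  coeff-*P : (f g : Poly n) (m : Mono n) → coeff (f *P g) m ≡ ∑ f (λ x → ∑ g (λ y → coeffᵗ m (x *ᵗ y)))
  coeff-*P f g m = trans (coeff-∑ (f *P g) m) (∑-*P f g (coeffᵗ m))

  quotCoeff : Poly n → Mono n → Mono n → ℤ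
  quotCoeff g u m with u ∣ᵐ? m
  ... | yes (w , _) = coeff g w
  ... | no _        = 0ℤ

  ∑-coeffᵗ-shift : (g : Poly n) (u m : Mono n) → ∑ g (λ (b , v) → ind (u ⊕ v ≟ᵐ m) b) ≡ quotCoeff g u m
  ∑-coeffᵗ-shift g u m with u ∣ᵐ? m
  ... | yes (w , u⊕w≡m) = trans
    (∑-cong g (λ (b , v) → ind-⇔ (u ⊕ v ≟ᵐ m) (v ≟ᵐ w)
      (λ e → ⊕-cancelˡ u v w (trans e (sym u⊕w≡m))) (λ e → trans (cong (u ⊕_) e) u⊕w≡m) b))
    (sym (coeff-∑ g w))
  ... | no u∤m = trans (∑-cong g (λ (b , v) → ind-no (u ⊕ v ≟ᵐ m) (λ e → u∤m (v , e)) b)) (∑-zero g)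

  coeff-*P-quot : (f g : Poly n) (m : Mono n) → coeff (f *P g) m ≡ ∑ f (λ (a , u) → a * quotCoeff g u m)
  coeff-*P-quot f g m = trans (coeff-*P f g m) (∑-cong f inner)
    where
    inner : ((a , u) : Term n) → ∑ g (λ y → coeffᵗ m ((a , u) *ᵗ y)) ≡ a * quotCoeff g u m
    inner (a , u) = trans (∑-cong g (λ (b , v) → ind-* (u ⊕ v ≟ᵐ m) a b))
                          (trans (∑-*ˡ g a _) (cong (a *_) (∑-coeffᵗ-shift g u m)))

  infix 4 _≐_
  record _≐_ (f g : Poly n) : Set where
    constructor mk≐
    field coeff≡ : ∀ m → coeff f m ≡ coeff g m
  open _≐_ public

  ≐-refl : {f : Poly n} → f ≐ f
  ≐-refl = mk≐ λ m → refl

  ≐-sym : {f g : Poly n} → f ≐ g → g ≐ f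
  ≐-sym f≐g = mk≐ λ m → sym (coeff≡ f≐g m)

  ≐-trans : {f g h : Poly n} → f ≐ g → g ≐ h → f ≐ h
  ≐-trans f≐g g≐h = mk≐ λ m → trans (coeff≡ f≐g m) (coeff≡ g≐h m)

  ≡⇒≐ : {f g : Poly n} → f ≡ g → f ≐ g
  ≡⇒≐ refl = ≐-refl

  +P-identityʳ : (f : Poly n) → f +P [] ≐ f
  +P-identityʳ f = ≡⇒≐ (ListP.++-identityʳ f)

  +P-assoc : (f g h : Poly n) → (f +P g) +P h ≐ f +P (g +P h)
  +P-assoc f g h = ≡⇒≐ (ListP.++-assoc f g h)

  +P-comm : (f g : Poly n) → f +P g ≐ g +P f
  +P-comm f g = mk≐ λ m → trans (coeff-+P f g m) (trans (ℤP.+-comm (coeff f m) _) (sym (coeff-+P g f m)))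

  -P-inverseˡ : (f : Poly n) → (-P f) +P f ≐ []
  -P-inverseˡ f = mk≐ λ m →
    trans (coeff-+P (-P f) f m) (trans (cong (_+ coeff f m) (coeff--P f m)) (ℤP.+-inverseˡ (coeff f m)))

  -P-inverseʳ : (f : Poly n) → f +P (-P f) ≐ []
  -P-inverseʳ f = ≐-trans (+P-comm f (-P f)) (-P-inverseˡ f)

  *ᵗ-comm : (x y : Term n) → x *ᵗ y ≡ y *ᵗ x
  *ᵗ-comm (a , u) (b , v) = cong₂ _,_ (ℤP.*-comm a b) (⊕-comm u v)

  *ᵗ-assoc : (x y z : Term n) → (x *ᵗ y) *ᵗ z ≡ x *ᵗ (y *ᵗ z)
  *ᵗ-assoc (a , u) (b , v) (c , w) = cong₂ _,_ (ℤP.*-assoc a b c) (⊕-assoc u v w)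

  *P-comm : (f g : Poly n) → f *P g ≐ g *P f
  *P-comm f g = mk≐ λ m → begin
    coeff (f *P g) m                               ≡⟨ coeff-*P f g m ⟩
    ∑ f (λ x → ∑ g (λ y → coeffᵗ m (x *ᵗ y)))     ≡⟨ ∑-swap f g _ ⟩
    ∑ g (λ y → ∑ f (λ x → coeffᵗ m (x *ᵗ y)))     ≡⟨ ∑-cong g (λ y → ∑-cong f (λ x → cong (coeffᵗ m) (*ᵗ-comm x y))) ⟩
    ∑ g (λ y → ∑ f (λ x → coeffᵗ m (y *ᵗ x)))     ≡⟨ sym (coeff-*P g f m) ⟩
    coeff (g *P f) m                               ∎
    where open ≡-Reasoning

  *P-assoc : (f g h : Poly n) → (f *P g) *P h ≐ f *P (g *P h)
  *P-assoc f g h = mk≐ λ m → begin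
    coeff ((f *P g) *P h) m                                        ≡⟨ coeff-*P (f *P g) h m ⟩
    ∑ (f *P g) (λ w → ∑ h (λ z → coeffᵗ m (w *ᵗ z)))              ≡⟨ ∑-*P f g _ ⟩
    ∑ f (λ x → ∑ g (λ y → ∑ h (λ z → coeffᵗ m ((x *ᵗ y) *ᵗ z)))) ≡⟨ ∑-cong f (λ x → ∑-cong g (λ y → ∑-cong h (λ z →
                                                                        cong (coeffᵗ m) (*ᵗ-assoc x y z)))) ⟩
    ∑ f (λ x → ∑ g (λ y → ∑ h (λ z → coeffᵗ m (x *ᵗ (y *ᵗ z))))) ≡⟨ ∑-cong f (λ x → sym (∑-*P g h (λ w → coeffᵗ m (x *ᵗ w)))) ⟩
    ∑ f (λ x → ∑ (g *P h) (λ w → coeffᵗ m (x *ᵗ w)))              ≡⟨ sym (coeff-*P f (g *P h) m) ⟩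
    coeff (f *P (g *P h)) m                                        ∎
    where open ≡-Reasoning

  *P-identityˡ : (f : Poly n) → monoP 𝟎 *P f ≐ f
  *P-identityˡ f = mk≐ λ m → trans (coeff-*P (monoP 𝟎) f m) (trans (ℤP.+-identityʳ _)
    (trans (∑-cong f (λ (c , u) → cong₂ (λ c′ u′ → ind (u′ ≟ᵐ m) c′) (ℤP.*-identityˡ c) (⊕-identityˡ u)))
           (sym (coeff-∑ f m))))

  *P-distribˡ : (f g h : Poly n) → f *P (g +P h) ≐ (f *P g) +P (f *P h)
  *P-distribˡ f g h = mk≐ λ m → begin
    coeff (f *P (g ++ h)) m                    ≡⟨ coeff-*P f (g ++ h) m ⟩
    ∑ f (λ x → ∑ (g ++ h) (λ y → coeffᵗ m (x *ᵗ y)))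
      ≡⟨ ∑-cong f (λ x → ∑-++ g h _) ⟩
    ∑ f (λ x → ∑ g (λ y → coeffᵗ m (x *ᵗ y)) + ∑ h (λ y → coeffᵗ m (x *ᵗ y)))
      ≡⟨ ∑-distrib-+ f _ _ ⟩
    ∑ f (λ x → ∑ g (λ y → coeffᵗ m (x *ᵗ y))) + ∑ f (λ x → ∑ h (λ y → coeffᵗ m (x *ᵗ y)))
      ≡⟨ sym (cong₂ _+_ (coeff-*P f g m) (coeff-*P f h m)) ⟩
    coeff (f *P g) m + coeff (f *P h) m        ≡⟨ sym (coeff-+P (f *P g) (f *P h) m) ⟩
    coeff ((f *P g) ++ (f *P h)) m             ∎
    where open ≡-Reasoning

  *P-distribʳ : (f g h : Poly n) → (g +P h) *P f ≐ (g *P f) +P (h *P f)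
  *P-distribʳ f g h = mk≐ λ m → begin
    coeff ((g ++ h) *P f) m                    ≡⟨ coeff-*P (g ++ h) f m ⟩
    ∑ (g ++ h) (λ x → ∑ f (λ y → coeffᵗ m (x *ᵗ y)))
      ≡⟨ ∑-++ g h _ ⟩
    ∑ g (λ x → ∑ f (λ y → coeffᵗ m (x *ᵗ y))) + ∑ h (λ x → ∑ f (λ y → coeffᵗ m (x *ᵗ y)))
      ≡⟨ sym (cong₂ _+_ (coeff-*P g f m) (coeff-*P h f m)) ⟩
    coeff (g *P f) m + coeff (h *P f) m        ≡⟨ sym (coeff-+P (g *P f) (h *P f) m) ⟩
    coeff ((g *P f) ++ (h *P f)) m             ∎
    where open ≡-Reasoning

  quotCoeff-cong : {g g′ : Poly n} → g ≐ g′ → ∀ u m → quotCoeff g u m ≡ quotCoeff g′ u m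
  quotCoeff-cong g≐g′ u m with u ∣ᵐ? m
  ... | yes (w , _) = coeff≡ g≐g′ w
  ... | no _        = refl

  *P-congˡ : (f : Poly n) {g g′ : Poly n} → g ≐ g′ → f *P g ≐ f *P g′
  *P-congˡ f {g} {g′} g≐g′ = mk≐ λ m → trans (coeff-*P-quot f g m)
    (trans (∑-cong f (λ (a , u) → cong (a *_) (quotCoeff-cong g≐g′ u m))) (sym (coeff-*P-quot f g′ m)))

  -P-*ˡ : (f g : Poly n) → (-P f) *P g ≐ -P (f *P g)
  -P-*ˡ f g = mk≐ λ m → begin
    coeff ((-P f) *P g) m                                ≡⟨ coeff-*P-quot (-P f) g m ⟩
    ∑ (-P f) (λ (a , u) → a * quotCoeff g u m)           ≡⟨ ∑-map _ f _ ⟩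
    ∑ f (λ (a , u) → - a * quotCoeff g u m)              ≡⟨ ∑-cong f (λ (a , u) → sym (ℤP.neg-distribˡ-* a _)) ⟩
    ∑ f (λ (a , u) → - (a * quotCoeff g u m))            ≡⟨ ∑-neg f _ ⟩
    - ∑ f (λ (a , u) → a * quotCoeff g u m)              ≡⟨ cong -_ (sym (coeff-*P-quot f g m)) ⟩
    - coeff (f *P g) m                                   ≡⟨ sym (coeff--P (f *P g) m) ⟩
    coeff (-P (f *P g)) m                                ∎
    where open ≡-Reasoning

module _ {n : ℕ} where

  infix 4 _≈[_]_
  record _≈[_]_ (f : Poly n) (d : ℕ) (g : Poly n) : Set where
    constructor mk≈
    field coeff≈ : ∀ m → + d ∣ coeff f m - coeff g m
  open _≈[_]_ public

  infix 4 _∣ₚ_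
  record _∣ₚ_ (d : ℕ) (f : Poly n) : Set where
    constructor mk∣
    field coeff∣ : ∀ m → + d ∣ coeff f m
  open _∣ₚ_ public

  module _ {d : ℕ} where

    ≐⇒≈ : {f g : Poly n} → f ≐ g → f ≈[ d ] g
    ≐⇒≈ f≐g = mk≈ λ m → subst (_ ∣_) (sym (ℤP.i≡j⇒i-j≡0 (coeff≡ f≐g m))) ∣0

    ≈-refl : {f : Poly n} → f ≈[ d ] f
    ≈-refl = ≐⇒≈ ≐-refl

    ≈-sym : {f g : Poly n} → f ≈[ d ] g → g ≈[ d ] f
    ≈-sym {f} {g} f≈g = mk≈ λ m → subst (_ ∣_) (lemma (coeff f m) (coeff g m)) (∣m⇒∣-m (coeff≈ f≈g m))
      where
      lemma : ∀ a b → - (a - b) ≡ b - a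
      lemma = solve-∀

    ≈-trans : {f g h : Poly n} → f ≈[ d ] g → g ≈[ d ] h → f ≈[ d ] h
    ≈-trans {f} {g} {h} f≈g g≈h = mk≈ λ m →
      subst (_ ∣_) (lemma (coeff f m) (coeff g m) (coeff h m)) (∣m∣n⇒∣m+n (coeff≈ f≈g m) (coeff≈ g≈h m))
      where
      lemma : ∀ a b c → (a - b) + (b - c) ≡ a - c
      lemma = solve-∀

    ≈-resp-≐ : {f f′ g g′ : Poly n} → f ≐ f′ → g ≐ g′ → f ≈[ d ] g → f′ ≈[ d ] g′
    ≈-resp-≐ f≐f′ g≐g′ f≈g = mk≈ λ m → subst (_ ∣_) (cong₂ _-_ (coeff≡ f≐f′ m) (coeff≡ g≐g′ m)) (coeff≈ f≈g m)

    +P-cong : {f f′ g g′ : Poly n} → f ≈[ d ] f′ → g ≈[ d ] g′ → f +P g ≈[ d ] f′ +P g′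
    +P-cong {f} {f′} {g} {g′} f≈f′ g≈g′ = mk≈ λ m → subst (_ ∣_)
      (sym (trans (cong₂ _-_ (coeff-+P f g m) (coeff-+P f′ g′ m)) (lemma (coeff f m) (coeff g m) (coeff f′ m) (coeff g′ m))))
      (∣m∣n⇒∣m+n (coeff≈ f≈f′ m) (coeff≈ g≈g′ m))
      where
      lemma : ∀ a b c e → (a + b) - (c + e) ≡ (a - c) + (b - e)
      lemma = solve-∀

    -P-cong : {f f′ : Poly n} → f ≈[ d ] f′ → -P f ≈[ d ] -P f′
    -P-cong {f} {f′} f≈f′ = mk≈ λ m → subst (_ ∣_)
      (sym (trans (cong₂ _-_ (coeff--P f m) (coeff--P f′ m)) (lemma (coeff f m) (coeff f′ m))))
      (∣m⇒∣-m (coeff≈ f≈f′ m))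
      where
      lemma : ∀ a b → (- a) - (- b) ≡ - (a - b)
      lemma = solve-∀

    quotCoeff-≈ : {g g′ : Poly n} → g ≈[ d ] g′ → ∀ u m → + d ∣ quotCoeff g u m - quotCoeff g′ u m
    quotCoeff-≈ g≈g′ u m with u ∣ᵐ? m
    ... | yes (w , _) = coeff≈ g≈g′ w
    ... | no _        = ∣0

    *P-congˡ-≈ : (f : Poly n) {g g′ : Poly n} → g ≈[ d ] g′ → f *P g ≈[ d ] f *P g′
    *P-congˡ-≈ f {g} {g′} g≈g′ = mk≈ λ m → subst (_ ∣_)
      (sym (trans (cong₂ _-_ (coeff-*P-quot f g m) (coeff-*P-quot f g′ m)) (∑-sub f _ _)))
      (∑-∣ f _ (λ (a , u) → subst (_ ∣_) (lemma a _ _) (∣n⇒∣m*n a (quotCoeff-≈ g≈g′ u m))))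
      where
      lemma : ∀ a b c → a * (b - c) ≡ a * b - a * c
      lemma = solve-∀

    *P-cong : {f f′ g g′ : Poly n} → f ≈[ d ] f′ → g ≈[ d ] g′ → f *P g ≈[ d ] f′ *P g′
    *P-cong {f} {f′} {g} {g′} f≈f′ g≈g′ =
      ≈-trans (*P-congˡ-≈ f g≈g′) (≈-resp-≐ (*P-comm g′ f) (*P-comm g′ f′) (*P-congˡ-≈ g′ f≈f′))

    ≈⇒∣ₚ-sub : {f g : Poly n} → f ≈[ d ] g → d ∣ₚ f +P (-P g)
    ≈⇒∣ₚ-sub {f} {g} f≈g = mk∣ λ m →
      subst (_ ∣_) (sym (trans (coeff-+P f (-P g) m) (cong (_+_ (coeff f m)) (coeff--P g m)))) (coeff≈ f≈g m)

    ≈[]⇒∣ₚ : {f : Poly n} → f ≈[ d ] [] → d ∣ₚ f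
    ≈[]⇒∣ₚ {f} f≈0 = mk∣ λ m → subst (_ ∣_) (ℤP.+-identityʳ (coeff f m)) (coeff≈ f≈0 m)

    ∣ₚ⇒≈[] : {f : Poly n} → d ∣ₚ f → f ≈[ d ] []
    ∣ₚ⇒≈[] {f} d∣f = mk≈ λ m → subst (_ ∣_) (sym (ℤP.+-identityʳ (coeff f m))) (coeff∣ d∣f m)

  ≈-weaken : ∀ {d d′} → + d ∣ + d′ → {f g : Poly n} → f ≈[ d′ ] g → f ≈[ d ] g
  ≈-weaken d∣d′ f≈g = mk≈ λ m → ∣-trans d∣d′ (coeff≈ f≈g m)

  ≈[0]⇒≐ : {f g : Poly n} → f ≈[ 0 ] g → f ≐ g
  ≈[0]⇒≐ {f} {g} f≈g = mk≐ λ m → ℤP.i-j≡0⇒i≡j (coeff f m) (coeff g m) (0∣⇒≡0 (coeff≈ f≈g m))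

  PolyRing : ℕ → CommutativeRing _ _
  PolyRing d = record
    { Carrier = Poly n
    ; _≈_ = _≈[ d ]_
    ; _+_ = _+P_
    ; _*_ = _*P_
    ; -_ = -P_
    ; 0# = []
    ; 1# = monoP 𝟎
    ; isCommutativeRing = record
      { isRing = record
        { +-isAbelianGroup = record
          { isGroup = record
            { isMonoid = record
              { isSemigroup = record
                { isMagma = record
                  { isEquivalence = record { refl = ≈-refl ; sym = ≈-sym ; trans = ≈-trans }
                  ; ∙-cong = +P-cong }
                ; assoc = λ f g h → ≐⇒≈ (+P-assoc f g h) }
              ; identity = (λ f → ≈-refl) , (λ f → ≐⇒≈ (+P-identityʳ f)) }
            ; inverse = (λ f → ≐⇒≈ (-P-inverseˡ f)) , (λ f → ≐⇒≈ (-P-inverseʳ f))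
            ; ⁻¹-cong = -P-cong }
          ; comm = λ f g → ≐⇒≈ (+P-comm f g) }
        ; *-cong = *P-cong
        ; *-assoc = λ f g h → ≐⇒≈ (*P-assoc f g h)
        ; *-identity = (λ f → ≐⇒≈ (*P-identityˡ f)) ,
                       (λ f → ≐⇒≈ (≐-trans (*P-comm f (monoP 𝟎)) (*P-identityˡ f)))
        ; distrib = (λ f g h → ≐⇒≈ (*P-distribˡ f g h)) , (λ f g h → ≐⇒≈ (*P-distribʳ f g h)) }
      ; *-comm = λ f g → ≐⇒≈ (*P-comm f g) } }

infix 4 _∤ₚ_
record _∤ₚ_ {n} (p : ℕ) (g : Poly n) : Set where
  constructor mk∤ₚ
  field
    unitMonomial : Mono n
    ∤-coeff : ¬ (+ p ∣ coeff g unitMonomial)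

∤ₚ-resp-≈ : ∀ {n p} {f g : Poly n} → f ≈[ p ] g → p ∤ₚ f → p ∤ₚ g
∤ₚ-resp-≈ {f = f} {g} f≈g (mk∤ₚ m p∤f) = mk∤ₚ m λ p∣g → p∤f (subst (_ ∣_) (lemma (coeff f m) (coeff g m)) (∣m∣n⇒∣m+n (coeff≈ f≈g m) p∣g))
  where
  lemma : ∀ a b → (a - b) + b ≡ a
  lemma = solve-∀

∤ₚ-one : ∀ {n} p .{{_ : ℕ.NonTrivial p}} → p ∤ₚ monoP (𝟎 {n})
∤ₚ-one {n} p = mk∤ₚ 𝟎 λ p∣1 → ℕP.<-irrefl (sym (ND.∣1⇒≡1 (∣⇒∣ᵤ {+ p} {+ 1} (subst (_ ∣_) coeff-one p∣1)))) (ℕ.nonTrivial⇒n>1 p)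
  where
  coeff-one : coeff (monoP (𝟎 {n})) 𝟎 ≡ + 1
  coeff-one = trans (coeff-∑ (monoP (𝟎 {n})) 𝟎) (trans (ℤP.+-identityʳ _) (ind-yes (𝟎 {n} ≟ᵐ 𝟎) refl (+ 1)))

-- The substitution Xᵢ ↦ Xᵢ^p

module Frobenius (p : ℕ) .{{_ : ℕ.NonZero p}} {n : ℕ} where

  fr : Poly n → Poly n
  fr = frobP p

  coeff-fr : (f : Poly n) (m : Mono n) → coeff (fr f) m ≡ ∑ f (λ (c , u) → ind (p ·ᵐ u ≟ᵐ m) c)
  coeff-fr f m = trans (coeff-∑ (fr f) m) (∑-map _ f (coeffᵗ m))

  coeff-fr-·ᵐ : (f : Poly n) (w : Mono n) → coeff (fr f) (p ·ᵐ w) ≡ coeff f w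
  coeff-fr-·ᵐ f w = trans (coeff-fr f (p ·ᵐ w)) (trans
    (∑-cong f (λ (c , u) → ind-⇔ (p ·ᵐ u ≟ᵐ p ·ᵐ w) (u ≟ᵐ w) (·ᵐ-cancelˡ p u w) (cong (p ·ᵐ_)) c))
    (sym (coeff-∑ f w)))

  coeff-fr-nonPower : (f : Poly n) (m : Mono n) → ¬ IsPower p m → coeff (fr f) m ≡ 0ℤ
  coeff-fr-nonPower f m ¬pow = trans (coeff-fr f m)
    (trans (∑-cong f (λ (c , u) → ind-no (p ·ᵐ u ≟ᵐ m) (λ e → ¬pow (u , e)) c)) (∑-zero f))

  fr-≈ : ∀ {d} {f g : Poly n} → f ≈[ d ] g → fr f ≈[ d ] fr g
  fr-≈ {d} {f} {g} f≈g = mk≈ λ m → at m (isPower? p m)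
    where
    at : ∀ m → Dec (IsPower p m) → + d ∣ coeff (fr f) m - coeff (fr g) m
    at m (yes (w , refl)) = subst (_ ∣_) (sym (cong₂ _-_ (coeff-fr-·ᵐ f w) (coeff-fr-·ᵐ g w))) (coeff≈ f≈g w)
    at m (no ¬pow) = subst (_ ∣_) (sym (cong₂ _-_ (coeff-fr-nonPower f m ¬pow) (coeff-fr-nonPower g m ¬pow))) ∣0

  fr-one : fr (monoP 𝟎) ≐ monoP 𝟎
  fr-one = ≡⇒≐ (cong (λ u → (+ 1 , u) ∷ []) (·ᵐ-zeroʳ p))

  fr-* : (f g : Poly n) → fr (f *P g) ≐ fr f *P fr g
  fr-* f g = mk≐ λ m → begin
    coeff (fr (f *P g)) m                                              ≡⟨ coeff-∑ (fr (f *P g)) m ⟩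
    ∑ (fr (f *P g)) (coeffᵗ m)                                         ≡⟨ ∑-map _ (f *P g) (coeffᵗ m) ⟩
    ∑ (f *P g) (λ (c , u) → coeffᵗ m (c , p ·ᵐ u))                    ≡⟨ ∑-*P f g _ ⟩
    ∑ f (λ (a , u) → ∑ g (λ (b , v) → coeffᵗ m (a * b , p ·ᵐ (u ⊕ v))))
      ≡⟨ ∑-cong f (λ (a , u) → ∑-cong g (λ (b , v) → cong (λ w → coeffᵗ m (a * b , w)) (·ᵐ-distrib-⊕ p u v))) ⟩
    ∑ f (λ (a , u) → ∑ g (λ (b , v) → coeffᵗ m ((a , p ·ᵐ u) *ᵗ (b , p ·ᵐ v))))
      ≡⟨ ∑-cong f (λ x → sym (∑-map _ g _)) ⟩
    ∑ f (λ (a , u) → ∑ (fr g) (λ y → coeffᵗ m ((a , p ·ᵐ u) *ᵗ y)))  ≡⟨ sym (∑-map _ f _) ⟩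
    ∑ (fr f) (λ x → ∑ (fr g) (λ y → coeffᵗ m (x *ᵗ y)))               ≡⟨ sym (coeff-*P (fr f) (fr g) m) ⟩
    coeff (fr f *P fr g) m                                             ∎
    where open ≡-Reasoning

  ∤ₚ-fr⁺ : {f : Poly n} → p ∤ₚ f → p ∤ₚ fr f
  ∤ₚ-fr⁺ {f} (mk∤ₚ m p∤f) = mk∤ₚ (p ·ᵐ m) λ p∣ → p∤f (subst (_ ∣_) (coeff-fr-·ᵐ f m) p∣)

  ∤ₚ-fr⁻ : {f : Poly n} → p ∤ₚ fr f → p ∤ₚ f
  ∤ₚ-fr⁻ {f} (mk∤ₚ m p∤fr) with isPower? p m
  ... | yes (w , refl) = mk∤ₚ w λ p∣ → p∤fr (subst (_ ∣_) (sym (coeff-fr-·ᵐ f w)) p∣)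
  ... | no ¬pow        = ⊥-elim (p∤fr (subst (_ ∣_) (sym (coeff-fr-nonPower f m ¬pow)) ∣0))

-- Gauss's lemma modulo p

module _ {n : ℕ} where

  coeff-filter : {Q : Mono n → Set} (Q? : ∀ u → Dec (Q u)) (f : Poly n) (m : Mono n) →
                 coeff (filter (λ (_ , u) → Q? u) f) m ≡ ind (Q? m) (coeff f m)
  coeff-filter Q? f m = begin
    coeff (filter (λ (_ , u) → Q? u) f) m                ≡⟨ coeff-∑ (filter (λ (_ , u) → Q? u) f) m ⟩
    ∑ (filter (λ (_ , u) → Q? u) f) (coeffᵗ m)           ≡⟨ ∑-filter _ f (coeffᵗ m) ⟩
    ∑ f (λ (c , u) → ind (Q? u) (ind (u ≟ᵐ m) c))        ≡⟨ ∑-cong f (λ (c , u) → move (u ≟ᵐ m) c) ⟩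
    ∑ f (λ t → ind (Q? m) (coeffᵗ m t))                  ≡⟨ ∑-ind (Q? m) f (coeffᵗ m) ⟩
    ind (Q? m) (∑ f (coeffᵗ m))                          ≡⟨ cong (ind (Q? m)) (sym (coeff-∑ f m)) ⟩
    ind (Q? m) (coeff f m)                               ∎
    where
    open ≡-Reasoning
    move : ∀ {u} (u≟m : Dec (u ≡ m)) c → ind (Q? u) (ind u≟m c) ≡ ind (Q? m) (ind u≟m c)
    move (yes refl) c = refl
    move {u} (no _) c = trans (ind-zero (Q? u)) (sym (ind-zero (Q? m)))

infix 4 _≤ˡᵉˣ_
_≤ˡᵉˣ_ : ∀ {n} → Mono n → Mono n → Set
Vec.[]      ≤ˡᵉˣ Vec.[]      = ⊤
(a Vec.∷ u) ≤ˡᵉˣ (b Vec.∷ v) = a < b ⊎ (a ≡ b × u ≤ˡᵉˣ v)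

≤ˡᵉˣ-refl : ∀ {n} (u : Mono n) → u ≤ˡᵉˣ u
≤ˡᵉˣ-refl Vec.[]      = tt
≤ˡᵉˣ-refl (a Vec.∷ u) = inj₂ (refl , ≤ˡᵉˣ-refl u)

≤ˡᵉˣ-trans : ∀ {n} {u v w : Mono n} → u ≤ˡᵉˣ v → v ≤ˡᵉˣ w → u ≤ˡᵉˣ w
≤ˡᵉˣ-trans {u = Vec.[]} {Vec.[]} {Vec.[]} _ _ = tt
≤ˡᵉˣ-trans {u = _ Vec.∷ _} {_ Vec.∷ _} {_ Vec.∷ _} (inj₁ a<b)         (inj₁ b<c)         = inj₁ (ℕP.<-trans a<b b<c)
≤ˡᵉˣ-trans {u = _ Vec.∷ _} {_ Vec.∷ _} {_ Vec.∷ _} (inj₁ a<b)         (inj₂ (refl , _))  = inj₁ a<b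
≤ˡᵉˣ-trans {u = _ Vec.∷ _} {_ Vec.∷ _} {_ Vec.∷ _} (inj₂ (refl , _))  (inj₁ b<c)         = inj₁ b<c
≤ˡᵉˣ-trans {u = _ Vec.∷ _} {_ Vec.∷ _} {_ Vec.∷ _} (inj₂ (refl , u≤v)) (inj₂ (refl , v≤w)) = inj₂ (refl , ≤ˡᵉˣ-trans u≤v v≤w)

≤ˡᵉˣ-total : ∀ {n} (u v : Mono n) → u ≤ˡᵉˣ v ⊎ v ≤ˡᵉˣ u
≤ˡᵉˣ-total Vec.[]      Vec.[]      = inj₁ tt
≤ˡᵉˣ-total (a Vec.∷ u) (b Vec.∷ v) with ℕP.<-cmp a b
... | tri< a<b _ _ = inj₁ (inj₁ a<b)
... | tri> _ _ b<a = inj₂ (inj₁ b<a)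
... | tri≈ _ refl _ with ≤ˡᵉˣ-total u v
...   | inj₁ u≤v = inj₁ (inj₂ (refl , u≤v))
...   | inj₂ v≤u = inj₂ (inj₂ (refl , v≤u))

⊕-≤ˡᵉˣ-cancel : ∀ {n} {u u₀ v v₀ : Mono n} → u ≤ˡᵉˣ u₀ → v ≤ˡᵉˣ v₀ → u ⊕ v ≡ u₀ ⊕ v₀ → u ≡ u₀ × v ≡ v₀
⊕-≤ˡᵉˣ-cancel {u = Vec.[]} {Vec.[]} {Vec.[]} {Vec.[]} _ _ _ = refl , refl
⊕-≤ˡᵉˣ-cancel {u = a Vec.∷ _} {_ Vec.∷ _} {_ Vec.∷ _} {_ Vec.∷ _} (inj₁ a<a₀) b≤b₀ e =
  ⊥-elim (ℕP.<-irrefl (proj₁ (∷-injective e)) (ℕP.+-mono-<-≤ a<a₀ (head≤ b≤b₀)))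
  where
  head≤ : ∀ {n b b₀} {v v₀ : Mono n} → (b Vec.∷ v) ≤ˡᵉˣ (b₀ Vec.∷ v₀) → b ℕ.≤ b₀
  head≤ (inj₁ b<b₀)     = ℕP.<⇒≤ b<b₀
  head≤ (inj₂ (refl , _)) = ℕP.≤-refl
⊕-≤ˡᵉˣ-cancel {u = a Vec.∷ _} {_ Vec.∷ _} {_ Vec.∷ _} {_ Vec.∷ _} (inj₂ (refl , _)) (inj₁ b<b₀) e =
  ⊥-elim (ℕP.<-irrefl (proj₁ (∷-injective e)) (ℕP.+-monoʳ-< a b<b₀))
⊕-≤ˡᵉˣ-cancel {u = _ Vec.∷ _} {_ Vec.∷ _} {_ Vec.∷ _} {_ Vec.∷ _} (inj₂ (refl , u≤u₀)) (inj₂ (refl , v≤v₀)) e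
  with ⊕-≤ˡᵉˣ-cancel u≤u₀ v≤v₀ (proj₂ (∷-injective e))
... | refl , refl = refl , refl

module _ {n : ℕ} where

  maxᵐ : Mono n → Poly n → Mono n
  maxᵐ d []             = d
  maxᵐ d ((_ , u) ∷ ts) with ≤ˡᵉˣ-total u (maxᵐ d ts)
  ... | inj₁ _ = maxᵐ d ts
  ... | inj₂ _ = u

  maxᵐ-upper : (d : Mono n) (ts : Poly n) → All (λ (_ , u) → u ≤ˡᵉˣ maxᵐ d ts) ts
  maxᵐ-upper d []             = []
  maxᵐ-upper d ((_ , u) ∷ ts) with ≤ˡᵉˣ-total u (maxᵐ d ts)
  ... | inj₁ u≤M = u≤M ∷ maxᵐ-upper d ts
  ... | inj₂ M≤u = ≤ˡᵉˣ-refl u ∷ All.map (λ v≤M → ≤ˡᵉˣ-trans v≤M M≤u) (maxᵐ-upper d ts)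

  maxᵐ-satisfies : {Q : Mono n → Set} (d : Mono n) (ts : Poly n) → Q d → All (λ (_ , u) → Q u) ts → Q (maxᵐ d ts)
  maxᵐ-satisfies d []             Qd _          = Qd
  maxᵐ-satisfies d ((_ , u) ∷ ts) Qd (Qu ∷ Qts) with ≤ˡᵉˣ-total u (maxᵐ d ts)
  ... | inj₁ _ = maxᵐ-satisfies d ts Qd Qts
  ... | inj₂ _ = Qu

  coeffᵗ-*ᵗ-top : {u₀ v₀ : Mono n} ((a , u) (b , v) : Term n) → u ≤ˡᵉˣ u₀ → v ≤ˡᵉˣ v₀ →
                  coeffᵗ (u₀ ⊕ v₀) ((a , u) *ᵗ (b , v)) ≡ coeffᵗ u₀ (a , u) * coeffᵗ v₀ (b , v)
  coeffᵗ-*ᵗ-top {u₀} {v₀} (a , u) (b , v) u≤u₀ v≤v₀ with u ⊕ v ≟ᵐ u₀ ⊕ v₀ | u ≟ᵐ u₀ | v ≟ᵐ v₀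
  ... | yes _ | yes _    | yes _    = refl
  ... | yes e | no u≢u₀  | _        = ⊥-elim (u≢u₀ (proj₁ (⊕-≤ˡᵉˣ-cancel u≤u₀ v≤v₀ e)))
  ... | yes e | yes _    | no v≢v₀  = ⊥-elim (v≢v₀ (proj₂ (⊕-≤ˡᵉˣ-cancel u≤u₀ v≤v₀ e)))
  ... | no ≢  | yes refl | yes refl = ⊥-elim (≢ refl)
  ... | no _  | no _     | v≟v₀     = sym (ℤP.*-zeroˡ (ind v≟v₀ b))
  ... | no _  | yes _    | no _     = sym (ℤP.*-zeroʳ a)

  coeff-*P-top : (F G : Poly n) {u₀ v₀ : Mono n} →
                 All (λ (_ , u) → u ≤ˡᵉˣ u₀) F → All (λ (_ , v) → v ≤ˡᵉˣ v₀) G →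
                 coeff (F *P G) (u₀ ⊕ v₀) ≡ coeff F u₀ * coeff G v₀
  coeff-*P-top F G {u₀} {v₀} F≤u₀ G≤v₀ = begin
    coeff (F *P G) (u₀ ⊕ v₀)                               ≡⟨ coeff-*P F G (u₀ ⊕ v₀) ⟩
    ∑ F (λ x → ∑ G (λ y → coeffᵗ (u₀ ⊕ v₀) (x *ᵗ y)))     ≡⟨ ∑-congᴬ (All.map (λ {x} x≤ → ∑-congᴬ
                                                                (All.map (λ {y} y≤ → coeffᵗ-*ᵗ-top x y x≤ y≤) G≤v₀)) F≤u₀) ⟩
    ∑ F (λ x → ∑ G (λ y → coeffᵗ u₀ x * coeffᵗ v₀ y))     ≡⟨ ∑-cong F (λ x → ∑-*ˡ G (coeffᵗ u₀ x) (coeffᵗ v₀)) ⟩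
    ∑ F (λ x → coeffᵗ u₀ x * ∑ G (coeffᵗ v₀))             ≡⟨ ∑-*ʳ F (coeffᵗ u₀) _ ⟩
    ∑ F (coeffᵗ u₀) * ∑ G (coeffᵗ v₀)                     ≡⟨ sym (cong₂ _*_ (coeff-∑ F u₀) (coeff-∑ G v₀)) ⟩
    coeff F u₀ * coeff G v₀                                ∎
    where open ≡-Reasoning

∤-* : ∀ {p} → Prime p → {a b : ℤ} → ¬ (+ p ∣ a) → ¬ (+ p ∣ b) → ¬ (+ p ∣ a * b)
∤-* {p} pp {a} {b} p∤a p∤b p∣ab
  with euclidsLemma ℤ.∣ a ∣ ℤ.∣ b ∣ pp (subst (p ND.∣_) (ℤP.abs-* a b) (∣⇒∣ᵤ {+ p} {a * b} p∣ab))
... | inj₁ p∣a = p∤a (∣ᵤ⇒∣ {+ p} {a} p∣a)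
... | inj₂ p∣b = p∤b (∣ᵤ⇒∣ {+ p} {b} p∣b)

module _ {n : ℕ} (p : ℕ) where

  unitPart : Poly n → Poly n
  unitPart f = filter (λ (_ , u) → ¬? (+ p ∣? coeff f u)) f

  unitPart-≈ : (f : Poly n) → unitPart f ≈[ p ] f
  unitPart-≈ f = mk≈ λ m → subst (_ ∣_) (cong (_- coeff f m) (sym (coeff-filter _ f m))) (at m (¬? (+ p ∣? coeff f m)))
    where
    at : ∀ m (p∤? : Dec (¬ (+ p ∣ coeff f m))) → + p ∣ ind p∤? (coeff f m) - coeff f m
    at m (yes _)  = subst (_ ∣_) (sym (ℤP.+-inverseʳ (coeff f m))) ∣0
    at m (no p∣f) = subst (_ ∣_) (sym (ℤP.+-identityˡ _)) (∣m⇒∣-m (decidable-stable (+ p ∣? coeff f m) p∣f))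

  unitPart-unit : (f : Poly n) (m : Mono n) → ¬ (+ p ∣ coeff f m) → coeff (unitPart f) m ≡ coeff f m
  unitPart-unit f m p∤f = trans (coeff-filter _ f m) (ind-yes (¬? (+ p ∣? coeff f m)) p∤f _)

-- The lexicographically largest monomials of f and g with coefficients prime to p multiply to such a monomial of f g.
∤ₚ-* : ∀ {n p} → Prime p → {f g : Poly n} → p ∤ₚ f → p ∤ₚ g → p ∤ₚ f *P g
∤ₚ-* {n} {p} pp {f} {g} (mk∤ₚ m p∤f) (mk∤ₚ m′ p∤g) =
  ∤ₚ-resp-≈ (*P-cong (unitPart-≈ p f) (unitPart-≈ p g)) (mk∤ₚ (u₀ ⊕ v₀) p∤top)
  where
  F G : Poly n
  F = unitPart p f
  G = unitPart p g
  u₀ v₀ : Mono n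
  u₀ = maxᵐ m F
  v₀ = maxᵐ m′ G
  p∤f₀ : ¬ (+ p ∣ coeff f u₀)
  p∤f₀ = maxᵐ-satisfies m F p∤f (all-filter _ f)
  p∤g₀ : ¬ (+ p ∣ coeff g v₀)
  p∤g₀ = maxᵐ-satisfies m′ G p∤g (all-filter _ g)
  p∤top : ¬ (+ p ∣ coeff (F *P G) (u₀ ⊕ v₀))
  p∤top = subst (λ c → ¬ (+ p ∣ c))
    (sym (trans (coeff-*P-top F G (maxᵐ-upper m F) (maxᵐ-upper m′ G))
                (cong₂ _*_ (unitPart-unit p f u₀ p∤f₀) (unitPart-unit p g v₀ p∤g₀))))
    (∤-* pp p∤f₀ p∤g₀)

module _ {n : ℕ} where
  open DecMembership (_≟ᵐ_ {n}) using (_∈?_)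

  monomials : Poly n → List (Mono n)
  monomials f = deduplicate _≟ᵐ_ (map proj₂ f)

  normalForm : Poly n → Poly n
  normalForm f = map (λ u → (coeff f u , u)) (monomials f)

  coeff-∉ : (f : Poly n) (m : Mono n) → m ∉ map proj₂ f → coeff f m ≡ 0ℤ
  coeff-∉ []             m m∉f = refl
  coeff-∉ ((c , u) ∷ f) m m∉f with u ≟ᵐ m
  ... | yes u≡m = ⊥-elim (m∉f (here (sym u≡m)))
  ... | no _    = coeff-∉ f m (λ m∈f → m∉f (there m∈f))

  normalForm-≐ : (f : Poly n) → normalForm f ≐ f
  normalForm-≐ f = mk≐ λ m → begin
    coeff (normalForm f) m                                   ≡⟨ coeff-∑ (normalForm f) m ⟩
    ∑ (normalForm f) (coeffᵗ m)                              ≡⟨ ∑-map _ (monomials f) (coeffᵗ m) ⟩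
    ∑ (monomials f) (λ u → ind (u ≟ᵐ m) (coeff f u))        ≡⟨ ∑-δ _≟ᵐ_ (DecUniqueP.deduplicate-! _≟ᵐ_ (map proj₂ f)) m (coeff f) ⟩
    ind (m ∈? monomials f) (coeff f m)                       ≡⟨ ind-self (m ∈? monomials f)
                                                                  (λ m∉ → coeff-∉ f m (λ m∈ → m∉ (∈P.∈-deduplicate⁺ _≟ᵐ_ m∈))) ⟩
    coeff f m                                                ∎
    where open ≡-Reasoning

  ∣ₚ-* : ∀ {d d′} {f g : Poly n} → d ∣ₚ f → d′ ∣ₚ g → ℕ._*_ d d′ ∣ₚ f *P g
  ∣ₚ-* {d} {d′} {f} {g} d∣f d′∣g = mk∣ λ m → subst (_ ∣_) (sym (coeff≡ f*g≐ m))
    (subst (_ ∣_) (sym (trans (coeff-*P-quot (normalForm f) g m) (∑-map _ (monomials f) _)))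
      (∑-∣ (monomials f) _ λ u → subst (_∣ _) (sym (ℤP.pos-* d d′))
        (∣-trans (*-monoˡ-∣ (+ d′) (coeff∣ d∣f u)) (*-monoʳ-∣ (coeff f u) (quotCoeff-∣ u m)))))
    where
    f*g≐ : f *P g ≐ normalForm f *P g
    f*g≐ = ≐-trans (*P-comm f g) (≐-trans (*P-congˡ g (≐-sym (normalForm-≐ f))) (*P-comm g (normalForm f)))
    quotCoeff-∣ : ∀ u m → + d′ ∣ quotCoeff g u m
    quotCoeff-∣ u m with u ∣ᵐ? m
    ... | yes (w , _) = coeff∣ d′∣g w
    ... | no _        = ∣0

-- Powers modulo p^e

module _ {n : ℕ} where

  infixr 25 _^P_
  _^P_ : Poly n → ℕ → Poly n
  f ^P zero  = monoP 𝟎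
  f ^P suc k = f *P (f ^P k)

  infixr 25 _×P_
  _×P_ : ℕ → Poly n → Poly n
  zero  ×P f = []
  suc k ×P f = f +P (k ×P f)

  coeff-×P : (k : ℕ) (f : Poly n) (m : Mono n) → coeff (k ×P f) m ≡ + k * coeff f m
  coeff-×P zero    f m = sym (ℤP.*-zeroˡ (coeff f m))
  coeff-×P (suc k) f m = begin
    coeff (f ++ k ×P f) m                  ≡⟨ coeff-+P f (k ×P f) m ⟩
    coeff f m + coeff (k ×P f) m           ≡⟨ cong₂ _+_ (sym (ℤP.*-identityˡ (coeff f m))) (coeff-×P k f m) ⟩
    + 1 * coeff f m + + k * coeff f m      ≡⟨ sym (ℤP.*-distribʳ-+ (coeff f m) (+ 1) (+ k)) ⟩
    + suc k * coeff f m                    ∎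
    where open ≡-Reasoning

  ∣⇒∣ₚ-×P : ∀ {d k} → d ND.∣ k → (f : Poly n) → d ∣ₚ k ×P f
  ∣⇒∣ₚ-×P {d} {k} d∣k f = mk∣ λ m → subst (_ ∣_) (sym (coeff-×P k f m))
    (∣m⇒∣m*n (coeff f m) (∣ᵤ⇒∣ {+ d} {+ k} d∣k))

module PolyRingPowers (d n : ℕ) where
  open CommutativeRing (PolyRing {n} d) using (semiring)
  module Exp  = SemiringExp semiring
  module Mult = SemiringMult semiring

  ^P≡^ : (x : Poly n) (k : ℕ) → x ^P k ≡ x Exp.^ k
  ^P≡^ x zero    = refl
  ^P≡^ x (suc k) = cong (x *P_) (^P≡^ x k)

  ×P≡× : (k : ℕ) (x : Poly n) → k ×P x ≡ k Mult.× x
  ×P≡× zero    x = refl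
  ×P≡× (suc k) x = cong (x +P_) (×P≡× k x)

  ^P-*-assoc : (x : Poly n) (a b : ℕ) → x ^P (a ℕ.* b) ≈[ d ] (x ^P a) ^P b
  ^P-*-assoc x a b = subst₂ _≈[ d ]_ (sym (^P≡^ x (a ℕ.* b))) (sym (trans (^P≡^ (x ^P a) b) (cong (Exp._^ b) (^P≡^ x a))))
    (CommutativeRing.sym (PolyRing d) (Exp.^-assocʳ x a b))

  ×P-congʳ : (k : ℕ) {x y : Poly n} → x ≈[ d ] y → k ×P x ≈[ d ] k ×P y
  ×P-congʳ k {x} {y} x≈y = subst₂ _≈[ d ]_ (sym (×P≡× k x)) (sym (×P≡× k y)) (Mult.×-congʳ k x≈y)

  *P-×P-comm : (k : ℕ) (x y : Poly n) → x *P (k ×P y) ≈[ d ] k ×P (x *P y)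
  *P-×P-comm k x y = subst₂ _≈[ d ]_ (sym (cong (x *P_) (×P≡× k y))) (sym (×P≡× k (x *P y))) (Mult.×-comm-* k x y)

prime∤! : ∀ {p} → Prime p → ∀ {m} → m < p → ¬ (p ND.∣ m !)
prime∤! {p} pp {zero}  _   p∣1 = ℕP.<-irrefl (sym (ND.∣1⇒≡1 p∣1)) (ℕ.nonTrivial⇒n>1 p {{prime⇒nonTrivial pp}})
prime∤! {p} pp {suc m} m<p p∣m! with euclidsLemma (suc m) (m !) pp p∣m!
... | inj₁ p∣1+m = ℕP.<-irrefl refl (ℕP.<-≤-trans m<p (ND.∣⇒≤ p∣1+m))
... | inj₂ p∣m!  = prime∤! pp (ℕP.<-trans (ℕP.n<1+n m) m<p) p∣m!

-- p divides p! = (p C j) · j! · (p - j)!, but neither of the factorials.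
prime∣C : ∀ {p} → Prime p → ∀ {j} → 0 < j → j < p → p ND.∣ p C j
prime∣C {p@(suc p′)} pp {j} 0<j j<p with k![n∸k]!∣n! {p} {j} (ℕP.<⇒≤ j<p)
... | ND.divides q p!≡q*d = subst (p ND.∣_) (sym C≡q) p∣q
  where
  d : ℕ
  d = j ! ℕ.* (p ℕ.∸ j) !
  instance
    d≢0 : ℕ.NonZero d
    d≢0 = j ℕP.!* (p ℕ.∸ j) !≢0
  C≡q : p C j ≡ q
  C≡q = trans (nCk≡n!/k![n-k]! (ℕP.<⇒≤ j<p)) (trans (cong (ℕ._/ d) p!≡q*d) (m*n/n≡m q d))
  p∣q : p ND.∣ q
  p∣q with euclidsLemma q d pp (subst (p ND.∣_) p!≡q*d (ND.m∣m*n (p′ !)))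
  ... | inj₁ p∣q = p∣q
  ... | inj₂ p∣d with euclidsLemma (j !) ((p ℕ.∸ j) !) pp p∣d
  ...   | inj₁ p∣j!   = ⊥-elim (prime∤! pp j<p p∣j!)
  ...   | inj₂ p∣p-j! = ⊥-elim (prime∤! pp (ℕP.∸-monoʳ-< {p} {j} {0} 0<j (ℕP.<⇒≤ j<p)) p∣p-j!)

freshman : ∀ {n p} → Prime p → (x y : Poly n) → (x +P y) ^P p ≈[ p ] x ^P p +P y ^P p
freshman {n} {suc p′} pp x y = begin
  (x +P y) ^P p                       ≡⟨ ^P≡^ (x +P y) p ⟩
  (x +P y) ^ᴿ p                       ≈⟨ B.theorem p x y ⟩
  B.binomialExpansion x y p           ≈⟨ R.+-cong (R.refl {x = term Fin.zero}) (S.sum-init-last {p′} (λ i → term (Fin.suc i))) ⟩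
  term Fin.zero +P (S.sum {p′} (λ i → term (Fin.suc (inject₁ i))) +P term (Fin.suc (fromℕ p′)))
                                      ≈⟨ R.+-cong firstTerm (R.+-cong middleTerms lastTerm) ⟩
  (y ^ᴿ p) +P ([] +P (x ^ᴿ p))        ≈⟨ R.+-comm (y ^ᴿ p) (x ^ᴿ p) ⟩
  (x ^ᴿ p) +P (y ^ᴿ p)                ≡⟨ sym (cong₂ _+P_ (^P≡^ x p) (^P≡^ y p)) ⟩
  x ^P p +P y ^P p                    ∎
  where
  p : ℕ
  p = suc p′
  module R = CommutativeRing (PolyRing {n} p)
  open PolyRingPowers p n
  open Exp using () renaming (_^_ to _^ᴿ_)
  module B = Binomial R.commutativeSemiring
  module S = MonoidSum R.+-monoid
  open SetoidReasoning R.setoid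

  term : Fin (suc p) → Poly n
  term = B.binomialTerm x y p

  firstTerm : term Fin.zero R.≈ y ^ᴿ p
  firstTerm = R.trans (R.+-identityʳ _) (R.*-identityˡ (y ^ᴿ p))

  middleTerms : S.sum {p′} (λ i → term (Fin.suc (inject₁ i))) R.≈ []
  middleTerms = R.trans (S.sum-cong-≋ {p′} vanishes) (S.sum-replicate-zero p′)
    where
    vanishes : (i : Fin p′) → term (Fin.suc (inject₁ i)) R.≈ []
    vanishes i = subst (R._≈ []) (×P≡× (p C suc (toℕ (inject₁ i))) _)
      (∣ₚ⇒≈[] (∣⇒∣ₚ-×P (prime∣C pp (ℕ.s≤s ℕ.z≤n) (ℕ.s≤s (subst (_< p′) (sym (FinP.toℕ-inject₁ i)) (FinP.toℕ<n i)))) _))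

  lastTerm : term (Fin.suc (fromℕ p′)) R.≈ x ^ᴿ p
  lastTerm = full (toℕ (Fin.suc (fromℕ p′))) (cong suc (FinP.toℕ-fromℕ p′))
    where
    full : ∀ k → k ≡ p → (p C k) Mult.× ((x ^ᴿ k) *P (y ^ᴿ (p ℕ.∸ k))) R.≈ x ^ᴿ p
    full k refl = begin
      (p C p) Mult.× ((x ^ᴿ p) *P (y ^ᴿ (p ℕ.∸ p)))
        ≡⟨ cong₂ (λ c e → c Mult.× ((x ^ᴿ p) *P (y ^ᴿ e))) (nCn≡1 p) (ℕP.n∸n≡0 p) ⟩
      1 Mult.× ((x ^ᴿ p) *P monoP 𝟎)  ≈⟨ R.+-identityʳ _ ⟩
      (x ^ᴿ p) *P monoP 𝟎             ≈⟨ R.*-identityʳ _ ⟩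
      x ^ᴿ p                          ∎

module _ {n : ℕ} where

  term-^P : (c : ℤ) (u : Mono n) (k : ℕ) → [ (c , u) ] ^P k ≐ [ (c ℤ.^ k , k ·ᵐ u) ]
  term-^P c u zero    = ≡⇒≐ (cong (λ w → [ (+ 1 , w) ]) (sym (·ᵐ-zeroˡ u)))
  term-^P c u (suc k) = ≐-trans (*P-congˡ [ (c , u) ] (term-^P c u k))
                                (≡⇒≐ (cong (λ w → [ (c * c ℤ.^ k , w) ]) (sym (·ᵐ-suc k u))))

  coeffPower : ℕ → Poly n → Poly n
  coeffPower k g = map (λ (c , u) → (c ℤ.^ k , u)) g

  ^P-prime-≈-frobP : ∀ {p} → Prime p → (g : Poly n) → g ^P p ≈[ p ] frobP p (coeffPower p g)
  ^P-prime-≈-frobP {suc p′} pp []             = ≈-refl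
  ^P-prime-≈-frobP {p}      pp ((c , u) ∷ g) = ≈-trans (freshman pp [ (c , u) ] g)
    (+P-cong (≐⇒≈ (term-^P c u p)) (^P-prime-≈-frobP pp g))

  geom : Poly n → Poly n → ℕ → Poly n
  geom a b zero    = []
  geom a b (suc m) = (a *P geom a b m) +P b ^P m

  module _ (d : ℕ) where
    private
      module R = CommutativeRing (PolyRing {n} d)
    open NatSolver R.commutativeSemiring

    -- a^m - b^m = (a - b) · geom a b m, with both sides moved so that no subtraction occurs.
    ^P-geom : (a b : Poly n) (m : ℕ) → (a ^P m) +P (b *P geom a b m) ≈[ d ] (b ^P m) +P (a *P geom a b m)
    ^P-geom a b zero = R.+-cong R.refl (R.trans (R.zeroʳ b) (R.sym (R.zeroʳ a)))
    ^P-geom a b (suc m) = R.trans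
      (solve 5 (λ a b bᵐ g aᵐ → ((a :* aᵐ) :+ (b :* ((a :* g) :+ bᵐ))) := ((a :* (aᵐ :+ (b :* g))) :+ (b :* bᵐ)))
        R.refl a b (b ^P m) (geom a b m) (a ^P m))
      (R.trans (R.+-cong (R.*-cong (R.refl {x = a}) (^P-geom a b m)) R.refl)
      (solve 5 (λ a b bᵐ g aᵐ → ((a :* (bᵐ :+ (a :* g))) :+ (b :* bᵐ)) := ((b :* bᵐ) :+ (a :* ((a :* g) :+ bᵐ))))
        R.refl a b (b ^P m) (geom a b m) (a ^P m)))

    geom-≈ : {a b : Poly n} → a ≈[ d ] b → ∀ m → geom a b (suc m) ≈[ d ] suc m ×P b ^P m
    geom-≈ {a} {b} a≈b zero = R.trans (R.+-cong (R.zeroʳ a) R.refl) (R.sym (R.+-identityʳ _))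
    geom-≈ {a} {b} a≈b (suc m) = R.trans (R.+-cong (R.*-cong a≈b (geom-≈ a≈b m)) R.refl)
      (R.trans (R.+-cong (*P-×P-comm (suc m) b (b ^P m)) R.refl) (R.+-comm _ (b ^P suc m)))
      where open PolyRingPowers d n

p∣p^suc : ∀ p k → + p ∣ + (p ^ suc k)
p∣p^suc p k = ∣ᵤ⇒∣ {+ p} {+ (p ^ suc k)} (ND.m∣m*n (p ^ k))

^P-lift : ∀ {n} p k {a b : Poly n} → a ≈[ p ^ suc k ] b → a ^P p ≈[ p ^ suc (suc k) ] b ^P p
^P-lift zero k a≈b = ≈-refl
^P-lift {n} p@(suc p′) k {a} {b} a≈b = subst (λ d → a ^P p ≈[ d ] b ^P p) (ℕP.*-comm (p ^ suc k) p) a^p≈b^p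
  where
  D : ℕ
  D = p ^ suc k ℕ.* p
  module R = CommutativeRing (PolyRing {n} D)
  open GroupProperties R.+-group using (x∙y⁻¹≈ε⇒x≈y; ∙-cancelʳ)
  G : Poly n
  G = geom a b p
  -- geom a b p ≡ p · b^(p-1) ≡ 0 modulo p, since a ≡ b modulo p
  p∣G : p ∣ₚ G
  p∣G = ≈[]⇒∣ₚ (≈-trans (geom-≈ p (≈-weaken (p∣p^suc p k) a≈b) p′) (∣ₚ⇒≈[] (∣⇒∣ₚ-×P (ND.∣-refl {p}) _)))
  [a-b]G≈0 : (a +P -P b) *P G R.≈ []
  [a-b]G≈0 = ∣ₚ⇒≈[] (∣ₚ-* (≈⇒∣ₚ-sub a≈b) p∣G)
  aG≈bG : a *P G R.≈ b *P G
  aG≈bG = x∙y⁻¹≈ε⇒x≈y _ _ (R.trans (R.+-cong (R.refl {x = a *P G}) (≐⇒≈ (≐-sym (-P-*ˡ b G))))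
                               (R.trans (R.sym (R.distribʳ G a (-P b))) [a-b]G≈0))
  a^p≈b^p : a ^P p R.≈ b ^P p
  a^p≈b^p = ∙-cancelʳ (b *P G) _ _ (R.trans (^P-geom D a b p) (R.+-cong (R.refl {x = b ^P p}) aG≈bG))

^P-p^k-lift : ∀ {n} p k {a b : Poly n} → a ≈[ p ] b → a ^P (p ^ k) ≈[ p ^ suc k ] b ^P (p ^ k)
^P-p^k-lift p zero {a} {b} a≈b =
  subst (λ d → a ^P 1 ≈[ d ] b ^P 1) (sym (ℕP.*-identityʳ p)) (*P-cong a≈b (≈-refl {f = monoP 𝟎}))
^P-p^k-lift {n} p (suc k) {a} {b} a≈b =
  ≈-trans (reassoc a) (≈-trans (^P-lift p k (^P-p^k-lift p k a≈b)) (≈-sym (reassoc b)))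
  where
  open PolyRingPowers (p ^ suc (suc k)) n using (^P-*-assoc)
  reassoc : ∀ x → x ^P (p ^ suc k) ≈[ p ^ suc (suc k) ] (x ^P (p ^ k)) ^P p
  reassoc x = subst (λ e → x ^P e ≈[ p ^ suc (suc k) ] (x ^P (p ^ k)) ^P p) (ℕP.*-comm (p ^ k) p) (^P-*-assoc x (p ^ k) p)

module _ {n p : ℕ} (pp : Prime p) where
  private instance
    p≢0 : ℕ.NonZero p
    p≢0 = prime⇒nonZero pp
  open Frobenius p {n}

  fr-^P : (g : Poly n) (k : ℕ) → fr (g ^P k) ≐ (fr g) ^P k
  fr-^P g zero    = fr-one
  fr-^P g (suc k) = ≐-trans (fr-* g (g ^P k)) (*P-congˡ (fr g) (fr-^P g k))

  ∤ₚ-^P : {g : Poly n} → p ∤ₚ g → ∀ k → p ∤ₚ g ^P k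
  ∤ₚ-^P p∤g zero    = ∤ₚ-one {n} p {{prime⇒nonTrivial pp}}
  ∤ₚ-^P {g} p∤g (suc k) = ∤ₚ-* pp {g} {g ^P k} p∤g (∤ₚ-^P p∤g k)

  ^P-p^e-≈-fr : {g : Poly n} → p ∤ₚ g → ∀ e → ∃ λ H → g ^P (p ^ suc e) ≈[ p ^ suc e ] fr H × p ∤ₚ H
  ^P-p^e-≈-fr {g} p∤g e = H , g^q≈frH , ∤ₚ-fr⁻ {H} (∤ₚ-resp-≈ (≈-weaken (p∣p^suc p e) g^q≈frH) (∤ₚ-^P p∤g (p ^ suc e)))
    where
    open PolyRingPowers (p ^ suc e) n using (^P-*-assoc)
    H : Poly n
    H = coeffPower p g ^P (p ^ e)
    g^q≈frH : g ^P (p ^ suc e) ≈[ p ^ suc e ] fr H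
    g^q≈frH = ≈-trans (^P-*-assoc g p (p ^ e))
      (≈-trans (^P-p^k-lift p e (^P-prime-≈-frobP pp g)) (≐⇒≈ (≐-sym (fr-^P (coeffPower p g) (p ^ e)))))

^P-*P-≈ : ∀ {n d} {s x y : Poly n} k .{{_ : ℕ.NonZero k}} → s *P x ≈[ d ] s *P y → s ^P k *P x ≈[ d ] s ^P k *P y
^P-*P-≈ {n} {d} {s} {x} {y} (suc k) sx≈sy =
  R.trans (reassoc x) (R.trans (R.*-cong (R.refl {x = s ^P k}) sx≈sy) (R.sym (reassoc y)))
  where
  module R = CommutativeRing (PolyRing {n} d)
  open NatSolver R.commutativeSemiring
  reassoc : ∀ z → (s *P s ^P k) *P z R.≈ s ^P k *P (s *P z)
  reassoc z = solve 3 (λ s sᵏ z → (s :* sᵏ) :* z := sᵏ :* (s :* z)) R.refl s (s ^P k) z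

-- Exponents modulo p

residue-unique : ∀ p .{{_ : ℕ.NonZero p}} {q q′ r r′} → r < p → r′ < p →
                 p ℕ.* q ℕ.+ r ≡ p ℕ.* q′ ℕ.+ r′ → q ≡ q′ × r ≡ r′
residue-unique p {q} {q′} {r} {r′} r<p r′<p e = q≡q′ , r≡r′
  where
  remainder : ∀ q r → r < p → (p ℕ.* q ℕ.+ r) ℕ.% p ≡ r
  remainder q r r<p = trans (cong (ℕ._% p) (trans (ℕP.+-comm (p ℕ.* q) r) (cong (r ℕ.+_) (ℕP.*-comm p q))))
                            (trans ([m+kn]%n≡m%n r q p) (m<n⇒m%n≡m r<p))
  r≡r′ : r ≡ r′
  r≡r′ = trans (sym (remainder q r r<p)) (trans (cong (ℕ._% p) e) (remainder q′ r′ r′<p))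
  q≡q′ : q ≡ q′
  q≡q′ = ℕP.*-cancelˡ-≡ q q′ p (ℕP.+-cancelʳ-≡ r _ _ (trans e (cong (p ℕ.* q′ ℕ.+_) (sym r≡r′))))

concatMap-map≡cartesianProductWith : {A B C : Set} (f : A → B → C) (xs : List A) (ys : List B) →
                                     concatMap (λ x → map (f x) ys) xs ≡ cartesianProductWith f xs ys
concatMap-map≡cartesianProductWith f []       ys = refl
concatMap-map≡cartesianProductWith f (x ∷ xs) ys = cong (map (f x) ys ++_) (concatMap-map≡cartesianProductWith f xs ys)

allIdx-unique : ∀ p k → Unique (allIdx p k)
allIdx-unique p zero    = [] ∷ []
allIdx-unique p (suc k) = subst Unique (sym (concatMap-map≡cartesianProductWith Vec._∷_ (allFin p) (allIdx p k)))
  (UniqueP.cartesianProductWith⁺ Vec._∷_ ∷-injective (UniqueP.allFin⁺ p) (allIdx-unique p k))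

∈-allIdx : ∀ {p k} (r : Vec (Fin p) k) → r ∈ allIdx p k
∈-allIdx Vec.[]      = here refl
∈-allIdx {p} {suc k} (i Vec.∷ r) = subst (_ ∈_) (sym (concatMap-map≡cartesianProductWith Vec._∷_ (allFin p) (allIdx p k)))
  (∈P.∈-cartesianProductWith⁺ Vec._∷_ (∈P.∈-allFin i) (∈-allIdx r))

∑-allIdx-δ : ∀ {p k} (r₀ : Vec (Fin p) k) (G : Vec (Fin p) k → ℤ) →
             ∑ (allIdx p k) (λ r → ind (≡-dec Fin._≟_ r r₀) (G r)) ≡ G r₀
∑-allIdx-δ {p} {k} r₀ G = trans (∑-δ (≡-dec Fin._≟_) (allIdx-unique p k) r₀ G) (ind-yes _ (∈-allIdx r₀) (G r₀))

module Residues (p : ℕ) .{{_ : ℕ.NonZero p}} {n : ℕ} where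
  open Frobenius p {n}

  Index : ℕ → Set
  Index k = Vec (Fin p) k

  infix 4 _≟ⁱ_
  _≟ⁱ_ : ∀ {k} → DecidableEquality (Index k)
  _≟ⁱ_ = ≡-dec Fin._≟_

  toMono : ∀ {k} → Index k → Mono k
  toMono = Vec.map toℕ

  glue : ∀ {k} → Mono k → Index k → Mono k
  glue q r = p ·ᵐ q ⊕ toMono r

  quotRem : ∀ {k} → Mono k → Mono k × Index k
  quotRem Vec.[]      = Vec.[] , Vec.[]
  quotRem (a Vec.∷ m) = a ℕ./ p Vec.∷ proj₁ (quotRem m) , fromℕ< (m%n<n a p) Vec.∷ proj₂ (quotRem m)

  glue-quotRem : ∀ {k} (m : Mono k) → glue (proj₁ (quotRem m)) (proj₂ (quotRem m)) ≡ m
  glue-quotRem Vec.[]      = refl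
  glue-quotRem (a Vec.∷ m) = cong₂ Vec._∷_ head≡ (glue-quotRem m)
    where
    head≡ : p ℕ.* (a ℕ./ p) ℕ.+ toℕ (fromℕ< (m%n<n a p)) ≡ a
    head≡ = trans (cong₂ ℕ._+_ (ℕP.*-comm p (a ℕ./ p)) (FinP.toℕ-fromℕ< _))
                  (trans (ℕP.+-comm _ (a ℕ.% p)) (sym (m≡m%n+[m/n]*n a p)))

  glue-injective : ∀ {k} {q q′ : Mono k} {r r′ : Index k} → glue q r ≡ glue q′ r′ → q ≡ q′ × r ≡ r′
  glue-injective {q = Vec.[]} {Vec.[]} {Vec.[]} {Vec.[]} e = refl , refl
  glue-injective {q = a Vec.∷ q} {b Vec.∷ q′} {i Vec.∷ r} {j Vec.∷ r′} e
    with ∷-injective e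
  ... | head≡ , tail≡ with residue-unique p (FinP.toℕ<n i) (FinP.toℕ<n j) head≡ | glue-injective tail≡
  ...   | refl , i≡j | refl , refl = refl , cong (Vec._∷ r) (FinP.toℕ-injective i≡j)

  ≐-byResidues : {f g : Poly n} → (∀ w r → coeff f (glue w r) ≡ coeff g (glue w r)) → f ≐ g
  ≐-byResidues {f} {g} f≡g = mk≐ λ m →
    subst (λ m → coeff f m ≡ coeff g m) (glue-quotRem m) (f≡g (proj₁ (quotRem m)) (proj₂ (quotRem m)))

  X : Index n → Poly n
  X r = monoP (toMono r)

  coeff-fr-*-X : (B : Poly n) (r r₀ : Index n) (w : Mono n) → coeff (fr B *P X r) (glue w r₀) ≡ ind (r ≟ⁱ r₀) (coeff B w)
  coeff-fr-*-X B r r₀ w = begin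
    coeff (fr B *P X r) (glue w r₀)                                   ≡⟨ coeff-*P (fr B) (X r) (glue w r₀) ⟩
    ∑ (fr B) (λ x → coeffᵗ (glue w r₀) (x *ᵗ (+ 1 , toMono r)) + 0ℤ) ≡⟨ ∑-map _ B _ ⟩
    ∑ B (λ (c , u) → ind (glue u r ≟ᵐ glue w r₀) (c * + 1) + 0ℤ)     ≡⟨ ∑-cong B (λ (c , u) → trans (ℤP.+-identityʳ _)
                                                                           (cong (ind (glue u r ≟ᵐ glue w r₀)) (ℤP.*-identityʳ c))) ⟩
    ∑ B (λ (c , u) → ind (glue u r ≟ᵐ glue w r₀) c)                  ≡⟨ ∑-cong B (λ (c , u) → ind-∧ (glue u r ≟ᵐ glue w r₀) (r ≟ⁱ r₀) (u ≟ᵐ w)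
                                                                           (λ e → swap (glue-injective e)) (λ { refl refl → refl }) c) ⟩
    ∑ B (λ t → ind (r ≟ⁱ r₀) (coeffᵗ w t))                           ≡⟨ ∑-ind (r ≟ⁱ r₀) B (coeffᵗ w) ⟩
    ind (r ≟ⁱ r₀) (∑ B (coeffᵗ w))                                    ≡⟨ cong (ind (r ≟ⁱ r₀)) (sym (coeff-∑ B w)) ⟩
    ind (r ≟ⁱ r₀) (coeff B w)                                         ∎
    where open ≡-Reasoning

  frobSum : (Index n → Poly n) → List (Index n) → Poly n
  frobSum A rs = foldr (λ r acc → (fr (A r) *P X r) +P acc) [] rs

  indices : List (Index n)
  indices = allIdx p n

  coeff-frobSum : (A : Index n → Poly n) (w : Mono n) (r₀ : Index n) → coeff (frobSum A indices) (glue w r₀) ≡ coeff (A r₀) w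
  coeff-frobSum A w r₀ = trans (coeff-frobSum-∑ indices) (trans (∑-cong indices (λ r → coeff-fr-*-X (A r) r r₀ w))
                                                         (∑-allIdx-δ r₀ (λ r → coeff (A r) w)))
    where
    coeff-frobSum-∑ : ∀ rs → coeff (frobSum A rs) (glue w r₀) ≡ ∑ rs (λ r → coeff (fr (A r) *P X r) (glue w r₀))
    coeff-frobSum-∑ []       = refl
    coeff-frobSum-∑ (r ∷ rs) = trans (coeff-+P (fr (A r) *P X r) (frobSum A rs) (glue w r₀))
                                     (cong (_+_ (coeff (fr (A r) *P X r) (glue w r₀))) (coeff-frobSum-∑ rs))

  component : Index n → Poly n → Poly n
  component r F = map (λ (c , m) → (c , proj₁ (quotRem m))) (filter (λ (c , m) → proj₂ (quotRem m) ≟ⁱ r) F)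

  coeff-component : (r : Index n) (F : Poly n) (w : Mono n) → coeff (component r F) w ≡ coeff F (glue w r)
  coeff-component r F w = begin
    coeff (component r F) w                                       ≡⟨ coeff-∑ (component r F) w ⟩
    ∑ (component r F) (coeffᵗ w)                                  ≡⟨ ∑-map _ (filter _ F) (coeffᵗ w) ⟩
    ∑ (filter _ F) (λ (c , m) → ind (quot m ≟ᵐ w) c)              ≡⟨ ∑-filter _ F _ ⟩
    ∑ F (λ (c , m) → ind (rem m ≟ⁱ r) (ind (quot m ≟ᵐ w) c))      ≡⟨ ∑-cong F (λ (c , m) → sym (ind-∧ (m ≟ᵐ glue w r) (rem m ≟ⁱ r) (quot m ≟ᵐ w)
                                                                       (λ { refl → quotRem-glue }) (λ { refl refl → sym (glue-quotRem m) }) c)) ⟩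
    ∑ F (coeffᵗ (glue w r))                                       ≡⟨ sym (coeff-∑ F (glue w r)) ⟩
    coeff F (glue w r)                                            ∎
    where
    open ≡-Reasoning
    quot : Mono n → Mono n
    quot m = proj₁ (quotRem m)
    rem : Mono n → Index n
    rem m = proj₂ (quotRem m)
    quotRem-glue : rem (glue w r) ≡ r × quot (glue w r) ≡ w
    quotRem-glue = swap (glue-injective (glue-quotRem (glue w r)))

  frobSum-component : (F : Poly n) → frobSum (λ r → component r F) indices ≐ F
  frobSum-component F = ≐-byResidues λ w r → trans (coeff-frobSum (λ r → component r F) w r) (coeff-component r F w)

  when : {P : Set} → Dec P → Poly n → Poly n
  when (yes _) A = A
  when (no _)  A = []

  coeff-when : {P : Set} (P? : Dec P) (A : Poly n) (m : Mono n) → coeff (when P? A) m ≡ ind P? (coeff A m)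
  coeff-when (yes _) A m = refl
  coeff-when (no _)  A m = refl

  frobSum-cong : ∀ {d} {U U′ : Index n → Poly n} rs → (∀ r → U r ≈[ d ] U′ r) → frobSum U rs ≈[ d ] frobSum U′ rs
  frobSum-cong []       U≈U′ = ≈-refl
  frobSum-cong (r ∷ rs) U≈U′ = +P-cong (*P-cong (fr-≈ (U≈U′ r)) ≈-refl) (frobSum-cong rs U≈U′)

  frobSum-≈⁻ : ∀ {d} {U U′ : Index n → Poly n} → frobSum U indices ≈[ d ] frobSum U′ indices → ∀ r → U r ≈[ d ] U′ r
  frobSum-≈⁻ {d} {U} {U′} ΣU≈ΣU′ r = mk≈ λ w →
    subst (_ ∣_) (cong₂ _-_ (coeff-frobSum U w r) (coeff-frobSum U′ w r)) (coeff≈ ΣU≈ΣU′ (glue w r))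

  frobSum-when : (r : Index n) (A : Poly n) → frobSum (λ r₀ → when (r ≟ⁱ r₀) A) indices ≐ fr A *P X r
  frobSum-when r A = ≐-byResidues λ w r₁ → trans (coeff-frobSum (λ r₀ → when (r ≟ⁱ r₀) A) w r₁)
    (trans (coeff-when (r ≟ⁱ r₁) A w) (sym (coeff-fr-*-X A r r₁ w)))

  frobSum-+P : (U V : Index n → Poly n) → frobSum (λ r → U r +P V r) indices ≐ frobSum U indices +P frobSum V indices
  frobSum-+P U V = ≐-byResidues λ w r → trans (coeff-frobSum (λ r → U r +P V r) w r) (trans (coeff-+P (U r) (V r) w)
    (sym (trans (coeff-+P (frobSum U indices) (frobSum V indices) (glue w r)) (cong₂ _+_ (coeff-frobSum U w r) (coeff-frobSum V w r)))))

  frobSum-[] : frobSum (λ _ → []) indices ≐ []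
  frobSum-[] = ≐-byResidues λ w r → coeff-frobSum (λ _ → []) w r

  frobSum-*-fr : (U : Index n → Poly n) (B : Poly n) (rs : List (Index n)) →
                 frobSum U rs *P fr B ≐ frobSum (λ r → U r *P B) rs
  frobSum-*-fr U B []       = ≐-refl
  frobSum-*-fr U B (r ∷ rs) = ≈[0]⇒≐ (ℤ[X].trans (ℤ[X].distribʳ (fr B) (fr (U r) *P X r) (frobSum U rs))
    (+P-cong (ℤ[X].trans (solve 3 (λ a x b → (a :* x) :* b := (a :* b) :* x) ℤ[X].refl (fr (U r)) (X r) (fr B))
                         (*P-cong (≐⇒≈ (≐-sym (fr-* (U r) B))) ≈-refl))
             (≐⇒≈ (frobSum-*-fr U B rs))))
    where
    module ℤ[X] = CommutativeRing (PolyRing {n} 0)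
    open NatSolver ℤ[X].commutativeSemiring

module Fractions {c ℓ} (R : CommutativeRing c ℓ) (S : CommutativeRing.Carrier R → Set)
                 (S-1 : S (CommutativeRing.1# R)) (S-* : ∀ {x y} → S x → S y → S (CommutativeRing._*_ R x y)) where
  private module R = CommutativeRing R
  open R using (Carrier; _≈_; 1#) renaming (_*_ to _·_)
  open NatSolver R.commutativeSemiring

  record FracEq (a b a′ b′ : Carrier) : Set (c ⊔ ℓ) where
    constructor fracEq
    field
      witness : Carrier
      witness∈S : S witness
      cross : witness · (a · b′) ≈ witness · (a′ · b)

  FracEq-exact : ∀ {a b a′ b′} → a · b′ ≈ a′ · b → FracEq a b a′ b′
  FracEq-exact ab′≈a′b = fracEq 1# S-1 (R.*-cong R.refl ab′≈a′b)

  FracEq-refl : ∀ {a b} → FracEq a b a b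
  FracEq-refl = FracEq-exact R.refl

  FracEq-sym : ∀ {a b a′ b′} → FracEq a b a′ b′ → FracEq a′ b′ a b
  FracEq-sym (fracEq s Ss eq) = fracEq s Ss (R.sym eq)

  FracEq-trans : ∀ {a b a′ b′ a″ b″} → S b′ → FracEq a b a′ b′ → FracEq a′ b′ a″ b″ → FracEq a b a″ b″
  FracEq-trans {a} {b} {a′} {b′} {a″} {b″} Sb′ (fracEq s Ss eq₁) (fracEq t St eq₂) =
    fracEq ((s · t) · b′) (S-* (S-* Ss St) Sb′) $
    R.trans (solve 7 (λ s t a b a′ b′ b″ → ((s :* t) :* b′) :* (a :* b″) := (s :* (a :* b′)) :* (t :* b″)) R.refl s t a b a′ b′ b″)
    (R.trans (R.*-cong eq₁ R.refl)
    (R.trans (solve 7 (λ s t a b a′ b′ b″ → (s :* (a′ :* b)) :* (t :* b″) := (t :* (a′ :* b″)) :* (s :* b)) R.refl s t a b a′ b′ b″)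
    (R.trans (R.*-cong eq₂ R.refl)
      (solve 7 (λ s t b b′ a″ b″ a′ → (t :* (a″ :* b′)) :* (s :* b) := ((s :* t) :* b′) :* (a″ :* b)) R.refl s t b b′ a″ b″ a′))))

  FracEq-+ : ∀ {a b a′ b′ c d c′ d′} → FracEq a b a′ b′ → FracEq c d c′ d′ →
             FracEq ((a · d) R.+ (c · b)) (b · d) ((a′ · d′) R.+ (c′ · b′)) (b′ · d′)
  FracEq-+ {a} {b} {a′} {b′} {c} {d} {c′} {d′} (fracEq s Ss eq₁) (fracEq t St eq₂) =
    fracEq (s · t) (S-* Ss St) $
    R.trans (solve 10 (λ s t a b a′ b′ c d c′ d′ →
               (s :* t) :* (((a :* d) :+ (c :* b)) :* (b′ :* d′))
                 := ((s :* (a :* b′)) :* (t :* (d :* d′))) :+ ((t :* (c :* d′)) :* (s :* (b :* b′))))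
               R.refl s t a b a′ b′ c d c′ d′)
    (R.trans (R.+-cong (R.*-cong eq₁ R.refl) (R.*-cong eq₂ R.refl))
      (solve 10 (λ s t a b a′ b′ c d c′ d′ →
               ((s :* (a′ :* b)) :* (t :* (d :* d′))) :+ ((t :* (c′ :* d)) :* (s :* (b :* b′)))
                 := (s :* t) :* (((a′ :* d′) :+ (c′ :* b′)) :* (b :* d)))
               R.refl s t a b a′ b′ c d c′ d′))

  FracEq-* : ∀ {a b a′ b′ c d c′ d′} → FracEq a b a′ b′ → FracEq c d c′ d′ →
             FracEq (a · c) (b · d) (a′ · c′) (b′ · d′)
  FracEq-* {a} {b} {a′} {b′} {c} {d} {c′} {d′} (fracEq s Ss eq₁) (fracEq t St eq₂) =
    fracEq (s · t) (S-* Ss St) $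
    R.trans (solve 10 (λ s t a b a′ b′ c d c′ d′ →
               (s :* t) :* ((a :* c) :* (b′ :* d′)) := (s :* (a :* b′)) :* (t :* (c :* d′)))
               R.refl s t a b a′ b′ c d c′ d′)
    (R.trans (R.*-cong eq₁ eq₂)
      (solve 10 (λ s t a b a′ b′ c d c′ d′ →
               (s :* (a′ :* b)) :* (t :* (c′ :* d)) := (s :* t) :* ((a′ :* c′) :* (b :* d)))
               R.refl s t a b a′ b′ c d c′ d′))

-- The decomposition

module Localisation {p : ℕ} (pp : Prime p) (e′ n : ℕ) where
  private instance
    p≢0 : ℕ.NonZero p
    p≢0 = prime⇒nonZero pp
  open Frobenius p {n}
  open Residues p {n}
  open Loc p (suc e′) n using (Frac; _/_; num; den; _+F_; _*F_; 0F; frobF; Xpow)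

  q : ℕ
  q = p ^ suc e′

  module Rq = CommutativeRing (PolyRing {n} q)
  module ℤ[X] = CommutativeRing (PolyRing {n} 0)

  open Fractions (PolyRing {n} q) (p ∤ₚ_) (∤ₚ-one p {{prime⇒nonTrivial pp}}) (λ {f} {g} → ∤ₚ-* pp {f} {g}) public

  infix 4 _≈ᶠ_
  _≈ᶠ_ : Frac → Frac → Set
  φ ≈ᶠ ψ = FracEq (num φ) (den φ) (num ψ) (den ψ)

  comboOn : List (Index n) → (Index n → Frac) → Frac
  comboOn rs c = foldr (λ r acc → (c r *F Xpow r) +F acc) 0F rs

  comboOn-cong : ∀ rs (c c′ : Index n → Frac) → (∀ r → c r ≈ᶠ c′ r) → comboOn rs c ≈ᶠ comboOn rs c′
  comboOn-cong []       c c′ c≈c′ = FracEq-refl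
  comboOn-cong (r ∷ rs) c c′ c≈c′ =
    FracEq-+ (FracEq-* (c≈c′ r) (FracEq-refl {num (Xpow r)} {den (Xpow r)})) (comboOn-cong rs c c′ c≈c′)

  comboOn-valid : ∀ rs (c : Index n → Frac) → (∀ r → p ∤ₚ den (c r)) → p ∤ₚ den (comboOn rs c)
  comboOn-valid []       c valid = ∤ₚ-one p {{prime⇒nonTrivial pp}}
  comboOn-valid (r ∷ rs) c valid = ∤ₚ-* pp (∤ₚ-* pp (valid r) (∤ₚ-one p {{prime⇒nonTrivial pp}})) (comboOn-valid rs c valid)

  frobF-cong : {φ ψ : Frac} → φ ≈ᶠ ψ → frobF φ ≈ᶠ frobF ψ
  frobF-cong {a / b} {a′ / b′} (fracEq s p∤s eq) = fracEq (fr s) (∤ₚ-fr⁺ p∤s) $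
    ≈-resp-≐ (≐-trans (fr-* s (a *P b′)) (*P-congˡ (fr s) (fr-* a b′)))
             (≐-trans (fr-* s (a′ *P b)) (*P-congˡ (fr s) (fr-* a′ b)))
             (fr-≈ eq)

  -- A witness s ∉ ⟨p⟩ may be replaced by s^q ≡ T(X₁^p, …, Xₙ^p).
  frobWitness : ∀ {s x y : Poly n} → p ∤ₚ s → s *P x ≈[ q ] s *P y → ∃ λ T → p ∤ₚ T × fr T *P x ≈[ q ] fr T *P y
  frobWitness {s} {x} {y} p∤s sx≈sy = T , p∤T ,
    Rq.trans (Rq.*-cong (Rq.sym s^q≈frT) (Rq.refl {x = x}))
      (Rq.trans (^P-*P-≈ q {{ℕP.m^n≢0 p (suc e′)}} sx≈sy) (Rq.*-cong s^q≈frT (Rq.refl {x = y})))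
    where
    T : Poly n
    T = proj₁ (^P-p^e-≈-fr pp p∤s e′)
    s^q≈frT : s ^P q ≈[ q ] fr T
    s^q≈frT = proj₁ (proj₂ (^P-p^e-≈-fr pp p∤s e′))
    p∤T : p ∤ₚ T
    p∤T = proj₂ (proj₂ (^P-p^e-≈-fr pp p∤s e′))

  count : List (Index n) → Index n → ℕ
  count []       r₀ = 0
  count (r ∷ rs) r₀ with r ≟ⁱ r₀
  ... | yes _ = suc (count rs r₀)
  ... | no _  = count rs r₀

  count-indices : ∀ r₀ → count indices r₀ ≡ 1
  count-indices r₀ = ℤP.+-injective (trans (count-∑ indices) (∑-allIdx-δ r₀ (λ _ → + 1)))
    where
    count-∑ : ∀ rs → + count rs r₀ ≡ ∑ rs (λ r → ind (r ≟ⁱ r₀) (+ 1))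
    count-∑ []       = refl
    count-∑ (r ∷ rs) with r ≟ⁱ r₀
    ... | yes _ = cong (_+_ (+ 1)) (count-∑ rs)
    ... | no _  = trans (count-∑ rs) (sym (ℤP.+-identityˡ _))

  -- The combination Σᵣ (αᵣ/βᵣ)(X̄^p) X^r over the common denominator W(X̄^p), W = Πᵣ βᵣ.
  module CommonDenominator (α β : Index n → Poly n) where
    open NatSolver ℤ[X].commutativeSemiring
    open PolyRingPowers 0 n using (×P-congʳ; *P-×P-comm)

    ψ : Index n → Frac
    ψ r = α r / β r

    W : List (Index n) → Poly n
    W []       = monoP 𝟎
    W (r ∷ rs) = β r *P W rs

    U : List (Index n) → Index n → Poly n
    U []       r₀ = []
    U (r ∷ rs) r₀ = when (r ≟ⁱ r₀) (α r *P W rs) +P (U rs r₀ *P β r)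

    W-valid : (∀ r → p ∤ₚ β r) → ∀ rs → p ∤ₚ W rs
    W-valid p∤β []       = ∤ₚ-one p {{prime⇒nonTrivial pp}}
    W-valid p∤β (r ∷ rs) = ∤ₚ-* pp (p∤β r) (W-valid p∤β rs)

    den-comboOn : ∀ rs → den (comboOn rs (frobF ∘ ψ)) ≐ fr (W rs)
    den-comboOn []       = ≐-sym fr-one
    den-comboOn (r ∷ rs) = ≈[0]⇒≐ (ℤ[X].trans (*P-cong (ℤ[X].*-identityʳ (fr (β r))) (≐⇒≈ (den-comboOn rs)))
                                               (≐⇒≈ (≐-sym (fr-* (β r) (W rs)))))

    num-comboOn : ∀ rs → num (comboOn rs (frobF ∘ ψ)) ≐ frobSum (U rs) indices
    num-comboOn []       = ≐-sym frobSum-[]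
    num-comboOn (r ∷ rs) = ≈[0]⇒≐ (begin
      ((fr (α r) *P X r) *P den (comboOn rs (frobF ∘ ψ))) +P (num (comboOn rs (frobF ∘ ψ)) *P (fr (β r) *P monoP 𝟎))
        ≈⟨ +P-cong (*P-cong (ℤ[X].refl {x = fr (α r) *P X r}) (≐⇒≈ (den-comboOn rs)))
                   (*P-cong (≐⇒≈ (num-comboOn rs)) (ℤ[X].*-identityʳ (fr (β r)))) ⟩
      ((fr (α r) *P X r) *P fr (W rs)) +P (frobSum (U rs) indices *P fr (β r))
        ≈⟨ +P-cong (solve 3 (λ a x w → (a :* x) :* w := (a :* w) :* x) ℤ[X].refl (fr (α r)) (X r) (fr (W rs)))
                   (≐⇒≈ (frobSum-*-fr (U rs) (β r) indices)) ⟩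
      ((fr (α r) *P fr (W rs)) *P X r) +P frobSum (λ r₀ → U rs r₀ *P β r) indices
        ≈⟨ +P-cong (*P-cong (≐⇒≈ (≐-sym (fr-* (α r) (W rs)))) ℤ[X].refl) ℤ[X].refl ⟩
      (fr (α r *P W rs) *P X r) +P frobSum (λ r₀ → U rs r₀ *P β r) indices
        ≈⟨ +P-cong (≐⇒≈ (≐-sym (frobSum-when r (α r *P W rs)))) ℤ[X].refl ⟩
      frobSum (λ r₀ → when (r ≟ⁱ r₀) (α r *P W rs)) indices +P frobSum (λ r₀ → U rs r₀ *P β r) indices
        ≈⟨ ≐⇒≈ (≐-sym (frobSum-+P (λ r₀ → when (r ≟ⁱ r₀) (α r *P W rs)) (λ r₀ → U rs r₀ *P β r))) ⟩
      frobSum (U (r ∷ rs)) indices ∎)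
      where open SetoidReasoning ℤ[X].setoid

    multiply-β : ∀ r rs r₀ → U rs r₀ *P β r₀ ≐ count rs r₀ ×P (α r₀ *P W rs) →
                 (U rs r₀ *P β r) *P β r₀ ℤ[X].≈ count rs r₀ ×P (α r₀ *P (β r *P W rs))
    multiply-β r rs r₀ spec = begin
      (U rs r₀ *P β r) *P β r₀                    ≈⟨ solve 3 (λ u b b₀ → (u :* b) :* b₀ := b :* (u :* b₀)) ℤ[X].refl (U rs r₀) (β r) (β r₀) ⟩
      β r *P (U rs r₀ *P β r₀)                    ≈⟨ *P-cong (ℤ[X].refl {x = β r}) (≐⇒≈ spec) ⟩
      β r *P (count rs r₀ ×P (α r₀ *P W rs))      ≈⟨ *P-×P-comm (count rs r₀) (β r) (α r₀ *P W rs) ⟩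
      count rs r₀ ×P (β r *P (α r₀ *P W rs))      ≈⟨ ×P-congʳ (count rs r₀) (solve 3 (λ b a w → b :* (a :* w) := a :* (b :* w))
                                                                                     ℤ[X].refl (β r) (α r₀) (W rs)) ⟩
      count rs r₀ ×P (α r₀ *P (β r *P W rs))      ∎
      where open SetoidReasoning ℤ[X].setoid

    U-spec : ∀ rs r₀ → U rs r₀ *P β r₀ ≐ count rs r₀ ×P (α r₀ *P W rs)
    U-spec []       r₀ = ≐-refl
    U-spec (r ∷ rs) r₀ with r ≟ⁱ r₀
    ... | yes refl = ≈[0]⇒≐ (ℤ[X].trans (ℤ[X].distribʳ (β r) (α r *P W rs) (U rs r *P β r))
      (+P-cong (solve 3 (λ a w b → (a :* w) :* b := a :* (b :* w)) ℤ[X].refl (α r) (W rs) (β r))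
               (multiply-β r rs r (U-spec rs r))))
    ... | no _     = ≈[0]⇒≐ (multiply-β r rs r₀ (U-spec rs r₀))

    U-indices : ∀ r → U indices r *P β r ≐ α r *P W indices
    U-indices r = ≐-trans (U-spec indices r)
      (≐-trans (≡⇒≐ (cong (_×P (α r *P W indices)) (count-indices r))) (+P-identityʳ (α r *P W indices)))

    ψ-≈ᶠ : ∀ r → ψ r ≈ᶠ U indices r / W indices
    ψ-≈ᶠ r = FracEq-exact (≐⇒≈ (≐-sym (U-indices r)))

    combo-≈ᶠ : comboOn indices (frobF ∘ ψ) ≈ᶠ frobSum (U indices) indices / fr (W indices)
    combo-≈ᶠ = FracEq-exact (*P-cong (≐⇒≈ (num-comboOn indices)) (≐⇒≈ (≐-sym (den-comboOn indices))))

  frobSum-/-injective : (U U′ : Index n → Poly n) (W W′ : Poly n) →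
                        frobSum U indices / fr W ≈ᶠ frobSum U′ indices / fr W′ → ∀ r → U r / W ≈ᶠ U′ r / W′
  frobSum-/-injective U U′ W W′ (fracEq s p∤s eq) r = fracEq T p∤T $ Rq.trans (≐⇒≈ (reassoc (U r) W′))
    (Rq.trans (frobSum-≈⁻ {U = λ r → U r *P (W′ *P T)} {U′ = λ r → U′ r *P (W *P T)}
                          (Rq.trans (≐⇒≈ (≐-sym (spread U W′))) (Rq.trans eqT (≐⇒≈ (spread U′ W)))) r)
              (≐⇒≈ (≐-sym (reassoc (U′ r) W))))
    where
    open NatSolver ℤ[X].commutativeSemiring
    T : Poly n
    T = proj₁ (frobWitness p∤s eq)
    p∤T : p ∤ₚ T
    p∤T = proj₁ (proj₂ (frobWitness p∤s eq))
    eqT : fr T *P (frobSum U indices *P fr W′) ≈[ q ] fr T *P (frobSum U′ indices *P fr W)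
    eqT = proj₂ (proj₂ (frobWitness p∤s eq))
    spread : ∀ V B → fr T *P (frobSum V indices *P fr B) ≐ frobSum (λ r → V r *P (B *P T)) indices
    spread V B = ≈[0]⇒≐ (begin
      fr T *P (frobSum V indices *P fr B)    ≈⟨ solve 3 (λ t v b → t :* (v :* b) := v :* (b :* t)) ℤ[X].refl (fr T) (frobSum V indices) (fr B) ⟩
      frobSum V indices *P (fr B *P fr T)    ≈⟨ *P-cong (ℤ[X].refl {x = frobSum V indices}) (≐⇒≈ (≐-sym (fr-* B T))) ⟩
      frobSum V indices *P fr (B *P T)       ≈⟨ ≐⇒≈ (frobSum-*-fr V (B *P T) indices) ⟩
      frobSum (λ r → V r *P (B *P T)) indices ∎)
      where open SetoidReasoning ℤ[X].setoid
    reassoc : ∀ u B → T *P (u *P B) ≐ u *P (B *P T)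
    reassoc u B = ≈[0]⇒≐ (solve 3 (λ t u b → t :* (u :* b) := u :* (b :* t)) ℤ[X].refl T u B)

  frobCombo-injective : (α β α′ β′ : Index n → Poly n) → (∀ r → p ∤ₚ β r) → (∀ r → p ∤ₚ β′ r) →
                        comboOn indices (λ r → frobF (α r / β r)) ≈ᶠ comboOn indices (λ r → frobF (α′ r / β′ r)) →
                        ∀ r → α r / β r ≈ᶠ α′ r / β′ r
  frobCombo-injective α β α′ β′ p∤β p∤β′ combo≈combo′ r =
    FracEq-trans (C.W-valid p∤β indices) (C.ψ-≈ᶠ r) $
    FracEq-trans (C′.W-valid p∤β′ indices) (frobSum-/-injective (C.U indices) (C′.U indices) (C.W indices) (C′.W indices) sums≈ r) $
    FracEq-sym (C′.ψ-≈ᶠ r)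
    where
    module C  = CommonDenominator α β
    module C′ = CommonDenominator α′ β′
    sums≈ : frobSum (C.U indices) indices / fr (C.W indices) ≈ᶠ frobSum (C′.U indices) indices / fr (C′.W indices)
    sums≈ = FracEq-trans (comboOn-valid indices (frobF ∘ C.ψ) (λ r → ∤ₚ-fr⁺ (p∤β r))) (FracEq-sym C.combo-≈ᶠ) $
            FracEq-trans (comboOn-valid indices (frobF ∘ C′.ψ) (λ r → ∤ₚ-fr⁺ (p∤β′ r))) combo≈combo′ C′.combo-≈ᶠ

  decompose : (F H : Poly n) → p ∤ₚ H → F / fr H ≈ᶠ comboOn indices (λ r → frobF (component r F / H))
  decompose F H p∤H = FracEq-trans (∤ₚ-fr⁺ (C.W-valid (λ _ → p∤H) indices)) F/H≈ (FracEq-sym C.combo-≈ᶠ)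
    where
    module C = CommonDenominator (λ r → component r F) (λ _ → H)
    F/H≈ : F / fr H ≈ᶠ frobSum (C.U indices) indices / fr (C.W indices)
    F/H≈ = FracEq-exact (begin
      F *P fr (C.W indices)                                 ≈⟨ *P-cong (≐⇒≈ (≐-sym (frobSum-component F))) Rq.refl ⟩
      frobSum (λ r → component r F) indices *P fr (C.W indices)
                                                            ≈⟨ ≐⇒≈ (frobSum-*-fr (λ r → component r F) (C.W indices) indices) ⟩
      frobSum (λ r → component r F *P C.W indices) indices ≈⟨ frobSum-cong indices (λ r → ≐⇒≈ (≐-sym (C.U-indices r))) ⟩
      frobSum (λ r → C.U indices r *P H) indices           ≈⟨ ≐⇒≈ (≐-sym (frobSum-*-fr (C.U indices) H indices)) ⟩
      frobSum (C.U indices) indices *P fr H                 ∎)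
      where open SetoidReasoning Rq.setoid

  -- f/g = f g^(q-1) / g^q with g^q ≡ H(X₁^p, …, Xₙ^p)
  frobDenominator : (f g : Poly n) → p ∤ₚ g → ∃ λ F → ∃ λ H → p ∤ₚ H × f / g ≈ᶠ F / fr H
  frobDenominator f g p∤g = f *P g ^P ℕ.pred q , H , p∤H , FracEq-exact (begin
    f *P fr H                          ≈⟨ *P-cong (Rq.refl {x = f}) (Rq.sym g^q≈frH) ⟩
    f *P g ^P q                        ≡⟨ cong (f *P_) (^P-pred q {{ℕP.m^n≢0 p (suc e′)}}) ⟩
    f *P (g *P g ^P ℕ.pred q)          ≈⟨ solve 3 (λ f g h → f :* (g :* h) := (f :* h) :* g) Rq.refl f g (g ^P ℕ.pred q) ⟩
    (f *P g ^P ℕ.pred q) *P g          ∎)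
    where
    open SetoidReasoning Rq.setoid
    open NatSolver Rq.commutativeSemiring
    H : Poly n
    H = proj₁ (^P-p^e-≈-fr pp p∤g e′)
    g^q≈frH : g ^P q ≈[ q ] fr H
    g^q≈frH = proj₁ (proj₂ (^P-p^e-≈-fr pp p∤g e′))
    p∤H : p ∤ₚ H
    p∤H = proj₂ (proj₂ (^P-p^e-≈-fr pp p∤g e′))
    ^P-pred : ∀ k .{{_ : ℕ.NonZero k}} → g ^P k ≡ g *P g ^P ℕ.pred k
    ^P-pred (suc k) = refl

module FrobeniusBasis {p : ℕ} (pp : Prime p) (e′ n : ℕ) where
  private instance
    p≢0 : ℕ.NonZero p
    p≢0 = prime⇒nonZero pp
  open Frobenius p {n}
  open Residues p {n} using (component; indices)
  open Localisation pp e′ n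
  open Loc p (suc e′) n

  ∤ₚ⇒NotDivP : {g : Poly n} → p ∤ₚ g → NotDivP g
  ∤ₚ⇒NotDivP (mk∤ₚ m p∤g) = m , λ p∣g → p∤g (∣ᵤ⇒∣ p∣g)

  NotDivP⇒∤ₚ : {g : Poly n} → NotDivP g → p ∤ₚ g
  NotDivP⇒∤ₚ (m , p∤g) = mk∤ₚ m λ p∣g → p∤g (∣⇒∣ᵤ p∣g)

  ≈ᶠ⇒≈ : {φ ψ : Frac} → φ ≈ᶠ ψ → φ ≈ ψ
  ≈ᶠ⇒≈ (fracEq s p∤s eq) = s , ∤ₚ⇒NotDivP p∤s , λ m → ∣⇒∣ᵤ (coeff≈ eq m)

  ≈⇒≈ᶠ : {φ ψ : Frac} → φ ≈ ψ → φ ≈ᶠ ψ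
  ≈⇒≈ᶠ (s , p∤s , eq) = fracEq s (NotDivP⇒∤ₚ p∤s) (mk≈ λ m → ∣ᵤ⇒∣ (eq m))

  existence : (φ : Frac) → Valid φ → ∃[ c ] (Coeffs c × (φ ≈ combo c))
  existence φ valid = c , coeffs , ≈ᶠ⇒≈ (FracEq-trans (∤ₚ-fr⁺ p∤H) φ≈F/H (decompose F H p∤H))
    where
    reduced : ∃[ F ] ∃[ H ] (p ∤ₚ H × φ ≈ᶠ F / fr H)
    reduced = frobDenominator (num φ) (den φ) (NotDivP⇒∤ₚ valid)
    F H : Poly n
    F = proj₁ reduced
    H = proj₁ (proj₂ reduced)
    p∤H : p ∤ₚ H
    p∤H = proj₁ (proj₂ (proj₂ reduced))
    φ≈F/H : φ ≈ᶠ F / fr H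
    φ≈F/H = proj₂ (proj₂ (proj₂ reduced))
    c : Index → Frac
    c r = frobF (component r F / H)
    coeffs : Coeffs c
    coeffs r = ∤ₚ⇒NotDivP (∤ₚ-fr⁺ p∤H) , (component r F / H , ∤ₚ⇒NotDivP p∤H , ≈ᶠ⇒≈ {c r} {c r} FracEq-refl)

  uniqueness : (c c′ : Index → Frac) → Coeffs c → Coeffs c′ → combo c ≈ combo c′ → ∀ r → c r ≈ c′ r
  uniqueness c c′ coeffs coeffs′ combo≈combo′ r = ≈ᶠ⇒≈ $
    FracEq-trans (∤ₚ-fr⁺ (p∤β r)) (c≈frobψ r) $
    FracEq-trans (∤ₚ-fr⁺ (p∤β′ r)) (frobF-cong ψ≈ψ′) $
    FracEq-sym (c′≈frobψ′ r)
    where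
    ψ ψ′ : Index → Frac
    ψ  r = proj₁ (proj₂ (coeffs r))
    ψ′ r = proj₁ (proj₂ (coeffs′ r))
    p∤β : ∀ r → p ∤ₚ den (ψ r)
    p∤β r = NotDivP⇒∤ₚ (proj₁ (proj₂ (proj₂ (coeffs r))))
    p∤β′ : ∀ r → p ∤ₚ den (ψ′ r)
    p∤β′ r = NotDivP⇒∤ₚ (proj₁ (proj₂ (proj₂ (coeffs′ r))))
    c≈frobψ : ∀ r → c r ≈ᶠ frobF (ψ r)
    c≈frobψ r = ≈⇒≈ᶠ (proj₂ (proj₂ (proj₂ (coeffs r))))
    c′≈frobψ′ : ∀ r → c′ r ≈ᶠ frobF (ψ′ r)
    c′≈frobψ′ r = ≈⇒≈ᶠ (proj₂ (proj₂ (proj₂ (coeffs′ r))))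
    combos≈ : comboOn indices (frobF ∘ ψ) ≈ᶠ comboOn indices (frobF ∘ ψ′)
    combos≈ =
      FracEq-trans (comboOn-valid indices c (λ r → NotDivP⇒∤ₚ (proj₁ (coeffs r))))
                   (comboOn-cong indices (frobF ∘ ψ) c (λ r → FracEq-sym (c≈frobψ r))) $
      FracEq-trans (comboOn-valid indices c′ (λ r → NotDivP⇒∤ₚ (proj₁ (coeffs′ r))))
                   (≈⇒≈ᶠ combo≈combo′) (comboOn-cong indices c′ (frobF ∘ ψ′) c′≈frobψ′)
    ψ≈ψ′ : ψ r ≈ᶠ ψ′ r
    ψ≈ψ′ = frobCombo-injective (num ∘ ψ) (den ∘ ψ) (num ∘ ψ′) (den ∘ ψ′) p∤β p∤β′ combos≈ r

lemma3p26 : (p e n : ℕ) → Prime p → 1 ≤ e →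
    let open Loc p e n in
    ((φ : Frac) → Valid φ → ∃[ c ] (Coeffs c × (φ ≈ combo c)))
    × ((c c' : Index → Frac) → Coeffs c → Coeffs c' →
         combo c ≈ combo c' → ∀ r → c r ≈ c' r)
lemma3p26 p (suc e′) n pp _ = existence , uniqueness
  where open FrobeniusBasis pp e′ n
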